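{- $$\sum_{n\ge0}(1\text{ - }2\text{ - }3)\,\mathcal{S}_n(2\text{ - }3\text{ - }1)\,z^n=z^3B^5C^3.$$
   Context: $\mathcal{S}_n(2\text{ - }3\text{ - }1)$ is the set of permutations $\sigma$ of $\{1,\dots,n\}$ with no $i<j<k$ such that $\sigma_k<\sigma_i<\sigma_j$. $(1\text{ - }2\text{ - }3)\sigma$ is the number of triples $i<j<k$ with $\sigma_i<\sigma_j<\sigma_k$, and $(1\text{ - }2\text{ - }3)S=\sum_{\sigma\in S}(1\text{ - }2\text{ - }3)\sigma$. $B=\frac{1}{\sqrt{1-4z}}$, $C=\frac{1-\sqrt{1-4z}}{2z}$. -}

module Defs where

open import Data.Nat using (ℕ; zero; suc; _+_; _*_; _∸_; _<ᵇ_; _/_)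
open import Data.Nat.Combinatorics using (_C_)
open import Data.Fin using (Fin; toℕ)
open import Data.List using (List; []; _∷_; [_]; map; concatMap; allFin; upTo; filterᵇ; all)
open import Data.Nat.ListAction using (sum)
open import Data.Vec using (Vec; lookup) renaming ([] to []ᵥ; _∷_ to _∷ᵥ_)
open import Data.Bool using (Bool; true; false; _∧_; not; if_then_else_)
open import Data.Product using (_×_; _,_)

words : (n k : ℕ) → List (Vec (Fin n) k)
words n zero    = [ []ᵥ ]
words n (suc k) = concatMap (λ a → map (a ∷ᵥ_) (words n k)) (allFin n)

triples : (n : ℕ) → List (Fin n × Fin n × Fin n)
triples n = concatMap (λ i → concatMap (λ j → map (λ k → (i , j , k)) (allFin n)) (allFin n)) (allFin n)

pairs : (n : ℕ) → List (Fin n × Fin n)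
pairs n = concatMap (λ i → map (λ j → (i , j)) (allFin n)) (allFin n)

_<ꟳ_ : {n : ℕ} → Fin n → Fin n → Bool
a <ꟳ b = toℕ a <ᵇ toℕ b

count : {A : Set} → (A → Bool) → List A → ℕ
count p xs = sum (map (λ x → if p x then 1 else 0) xs)

-- σ is a permutation of {0..n-1}: injective (i < j ⇒ σ_i ≠ σ_j), hence bijective.
isPerm : {n : ℕ} → Vec (Fin n) n → Bool
isPerm {n} σ = all (λ { (i , j) → not (i <ꟳ j) ∨' not ((toℕ (lookup σ i)) ≡ᵇ' (toℕ (lookup σ j))) }) (pairs n)
  where
  _∨'_ : Bool → Bool → Bool
  true ∨' _ = true
  false ∨' b = b
  _≡ᵇ'_ : ℕ → ℕ → Bool
  zero ≡ᵇ' zero = true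
  suc a ≡ᵇ' suc b = a ≡ᵇ' b
  _ ≡ᵇ' _ = false

occ123 : {n : ℕ} → Vec (Fin n) n → Fin n × Fin n × Fin n → Bool
occ123 σ (i , j , k) = (i <ꟳ j) ∧ (j <ꟳ k) ∧ (lookup σ i <ꟳ lookup σ j) ∧ (lookup σ j <ꟳ lookup σ k)

occ231 : {n : ℕ} → Vec (Fin n) n → Fin n × Fin n × Fin n → Bool
occ231 σ (i , j , k) = (i <ꟳ j) ∧ (j <ꟳ k) ∧ (lookup σ k <ꟳ lookup σ i) ∧ (lookup σ i <ꟳ lookup σ j)

num123 : {n : ℕ} → Vec (Fin n) n → ℕ
num123 {n} σ = count (occ123 σ) (triples n)

avoids231 : {n : ℕ} → Vec (Fin n) n → Bool
avoids231 {n} σ = count (occ231 σ) (triples n) ≡ᵇ0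
  where
  _≡ᵇ0 : ℕ → Bool
  zero ≡ᵇ0 = true
  suc _ ≡ᵇ0 = false

-- S_n(2-3-1), permutations written in one-line notation σ = (σ_0,…,σ_{n-1}) on {0..n-1}
S231 : (n : ℕ) → List (Vec (Fin n) n)
S231 n = filterᵇ (λ σ → isPerm σ ∧ avoids231 σ) (words n n)

total123 : ℕ → ℕ
total123 n = sum (map num123 (S231 n))

Series : Set
Series = ℕ → ℕ

_⊛_ : Series → Series → Series
(f ⊛ g) n = sum (map (λ i → f i * g (n ∸ i)) (upTo (suc n)))

_^ˢ_ : Series → ℕ → Series
f ^ˢ zero = λ { zero → 1 ; (suc _) → 0 }
f ^ˢ suc m = f ⊛ (f ^ˢ m)

z³· : Series → Series
z³· f (suc (suc (suc m))) = f m
z³· f _ = 0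

-- B = 1/√(1-4z) = Σ binom(2n,n) z^n
Bser : Series
Bser n = (2 * n) C n

-- C = (1-√(1-4z))/(2z) = Σ Catalan(n) z^n, Catalan(n) = binom(2n,n)/(n+1)
Cser : Series
Cser n = ((2 * n) C n) / suc n

-- A 231-avoiding permutation of {0, …, n} beginning with m has the form m α β′, where α is a
-- 231-avoiding permutation of {0, …, m-1} and β′ one of {m+1, …, n}: an entry below m after
-- an entry above m would complete a 2-3-1.  Tracking occurrences of 1-2 and 1-2-3 through this
-- decomposition gives, for the generating functions c, p and t of the number of such
-- permutations, of their 1-2 occurrences and of their 1-2-3 occurrences, with D = z d/dz,
--   c = 1 + z c²,   p = z (c Dc + 2 p c + (Dc)²),   t = z (c p + 2 t c + 2 p Dc).
-- The series b = c + Dc satisfies b = 1 + 2 z c b, hence Dc = z b c²; b is identified with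
-- B through the recurrence (n+1) B(n+1) = (4n+2) B(n) of the central binomial coefficients,
-- and c = C follows from b(n) = (n+1) c(n).  The equations for p and t are linear with the
-- same kernel 2 z c, so their solutions are unique, and one checks that z² b³ c² and
-- z³ b⁵ c³ solve them.

module Submission where

open import Defs
open import Data.Nat using (ℕ)
open import Relation.Binary.PropositionalEquality using (_≡_; trans)

module ListSums where

  open import Data.Nat using (ℕ; _+_; _*_)
  open import Data.Nat.Properties using (*-comm; *-distribˡ-+; *-zeroʳ; +-commutativeSemigroup)
  open import Data.Nat.ListAction using (sum)
  open import Data.Nat.ListAction.Properties using (sum-++)
  open import Data.List using (List; []; _∷_; _++_; map; concatMap)
  open import Data.List.Properties using (map-++)
  open import Data.List.Membership.Propositional using (_∈_)
  open import Data.List.Relation.Unary.Any using (here; there)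
  open import Algebra.Properties.CommutativeSemigroup +-commutativeSemigroup using (interchange)
  open import Relation.Binary.PropositionalEquality
  open import Data.Product using (_×_; _,_)
  open import Function using (_∘_)

  sumMap : {A : Set} → (A → ℕ) → List A → ℕ
  sumMap f xs = sum (map f xs)

  sumMap-++ : {A : Set} (f : A → ℕ) (xs ys : List A) → sumMap f (xs ++ ys) ≡ sumMap f xs + sumMap f ys
  sumMap-++ f xs ys = trans (cong sum (map-++ f xs ys)) (sum-++ (map f xs) (map f ys))

  sumMap-+ : {A : Set} (f g : A → ℕ) (xs : List A) → sumMap (λ x → f x + g x) xs ≡ sumMap f xs + sumMap g xs
  sumMap-+ f g [] = refl
  sumMap-+ f g (x ∷ xs) =
    trans (cong (f x + g x +_) (sumMap-+ f g xs)) (interchange (f x) (g x) (sumMap f xs) (sumMap g xs))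

  sumMap-*ˡ : {A : Set} (a : ℕ) (f : A → ℕ) (xs : List A) → sumMap (λ x → a * f x) xs ≡ a * sumMap f xs
  sumMap-*ˡ a f [] = sym (*-zeroʳ a)
  sumMap-*ˡ a f (x ∷ xs) = trans (cong (a * f x +_) (sumMap-*ˡ a f xs)) (sym (*-distribˡ-+ a (f x) (sumMap f xs)))

  sumMap-cong-∈ : {A : Set} {f g : A → ℕ} (xs : List A) → (∀ {x} → x ∈ xs → f x ≡ g x) → sumMap f xs ≡ sumMap g xs
  sumMap-cong-∈ [] e = refl
  sumMap-cong-∈ (x ∷ xs) e = cong₂ _+_ (e (here refl)) (sumMap-cong-∈ xs (e ∘ there))

  sumMap-cong : {A : Set} {f g : A → ℕ} → (∀ x → f x ≡ g x) → (xs : List A) → sumMap f xs ≡ sumMap g xs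
  sumMap-cong e xs = sumMap-cong-∈ xs (λ {x} _ → e x)

  sumMap-zero : {A : Set} (xs : List A) → sumMap (λ _ → 0) xs ≡ 0
  sumMap-zero [] = refl
  sumMap-zero (x ∷ xs) = sumMap-zero xs

  sumMap-map : {A B : Set} (f : B → ℕ) (h : A → B) (xs : List A) → sumMap f (map h xs) ≡ sumMap (f ∘ h) xs
  sumMap-map f h [] = refl
  sumMap-map f h (x ∷ xs) = cong (f (h x) +_) (sumMap-map f h xs)

  sumMap-concatMap : {A B : Set} (f : B → ℕ) (g : A → List B) (xs : List A) →
    sumMap f (concatMap g xs) ≡ sumMap (λ x → sumMap f (g x)) xs
  sumMap-concatMap f g [] = refl
  sumMap-concatMap f g (x ∷ xs) =
    trans (sumMap-++ f (g x) (concatMap g xs)) (cong (sumMap f (g x) +_) (sumMap-concatMap f g xs))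

  sumMap²-+ : {A B : Set} (as : List A) (bs : List B) (f g : A → B → ℕ) →
    sumMap (λ a → sumMap (λ b → f a b + g a b) bs) as ≡
    sumMap (λ a → sumMap (f a) bs) as + sumMap (λ a → sumMap (g a) bs) as
  sumMap²-+ as bs f g = trans (sumMap-cong (λ a → sumMap-+ (f a) (g a) bs) as) (sumMap-+ _ _ as)

  sumMap²-* : {A B : Set} (as : List A) (bs : List B) (u : A → ℕ) (v : B → ℕ) →
    sumMap (λ a → sumMap (λ b → u a * v b) bs) as ≡ sumMap u as * sumMap v bs
  sumMap²-* as bs u v = begin
    sumMap (λ a → sumMap (λ b → u a * v b) bs) as  ≡⟨ sumMap-cong (λ a → sumMap-*ˡ (u a) v bs) as ⟩
    sumMap (λ a → u a * sumMap v bs) as            ≡⟨ sumMap-cong (λ a → *-comm (u a) (sumMap v bs)) as ⟩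
    sumMap (λ a → sumMap v bs * u a) as            ≡⟨ sumMap-*ˡ (sumMap v bs) u as ⟩
    sumMap v bs * sumMap u as                      ≡⟨ *-comm (sumMap v bs) (sumMap u as) ⟩
    sumMap u as * sumMap v bs                      ∎
    where open ≡-Reasoning


  sumMap²-bilinear : {A B : Set} (as : List A) (bs : List B) (terms : List ((A → ℕ) × (B → ℕ))) →
    sumMap (λ a → sumMap (λ b → sumMap (λ (u , v) → u a * v b) terms) bs) as
      ≡ sumMap (λ (u , v) → sumMap u as * sumMap v bs) terms
  sumMap²-bilinear as bs [] = trans (sumMap-cong (λ a → sumMap-zero bs) as) (sumMap-zero as)
  sumMap²-bilinear as bs ((u , v) ∷ terms) =
    trans (sumMap²-+ as bs (λ a b → u a * v b) (λ a b → sumMap (λ (u , v) → u a * v b) terms))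
          (cong₂ _+_ (sumMap²-* as bs u v) (sumMap²-bilinear as bs terms))

module PowerSeries where

  open ListSums
  open import Data.Nat using (ℕ; zero; suc; _+_; _*_; _∸_; _≤_; z≤n)
  open import Data.Nat.Properties
  open import Data.Nat.ListAction using (sum)
  open import Data.List using (upTo)
  open import Data.List.Properties using (map-cong; map-applyUpTo)
  open import Data.Product using (_,_)
  open import Data.Sum using (inj₁; inj₂)
  open import Algebra.Bundles using (CommutativeSemiring)
  open import Algebra.Structures using (IsCommutativeMonoid)
  open import Algebra.Structures.Biased using (IsCommutativeSemiringˡ)
  import Algebra.Solver.Ring.NaturalCoefficients.Default
  open import Relation.Binary.Structures using (IsEquivalence)
  open import Relation.Binary.PropositionalEquality
  open import Data.Nat.Solver using (module +-*-Solver)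
  open +-*-Solver using (_:+_; _:*_; _:=_; con) renaming (solve to solveℕ)

  infix 4 _≈ₛ_
  infixl 6 _⊕_

  _≈ₛ_ : Series → Series → Set
  f ≈ₛ g = ∀ n → f n ≡ g n

  _⊕_ : Series → Series → Series
  (f ⊕ g) n = f n + g n

  0ₛ 1ₛ zₛ : Series
  0ₛ _ = 0
  1ₛ zero = 1
  1ₛ (suc _) = 0
  zₛ (suc zero) = 1
  zₛ _ = 0

  tail : Series → Series
  tail f n = f (suc n)

  _·ₛ_ : ℕ → Series → Series
  (a ·ₛ f) n = a * f n

  ⊛-suc : (f g : Series) (n : ℕ) → (f ⊛ g) (suc n) ≡ f 0 * g (suc n) + (tail f ⊛ g) n
  ⊛-suc f g n = cong (λ l → f 0 * g (suc n) + sum l)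
    (trans (map-applyUpTo suc (λ i → f i * g (suc n ∸ i)) (suc n))
           (sym (map-applyUpTo (λ i → i) (λ i → tail f i * g (n ∸ i)) (suc n))))

  ⊛-cong : {f f′ g g′ : Series} → f ≈ₛ f′ → g ≈ₛ g′ → f ⊛ g ≈ₛ f′ ⊛ g′
  ⊛-cong ef eg n = cong sum (map-cong (λ i → cong₂ _*_ (ef i) (eg (n ∸ i))) (upTo (suc n)))

  ⊛-congˡ : (f : Series) {g g′ : Series} → g ≈ₛ g′ → f ⊛ g ≈ₛ f ⊛ g′
  ⊛-congˡ f = ⊛-cong {f} (λ _ → refl)

  ⊛-congʳ : (g : Series) {f f′ : Series} → f ≈ₛ f′ → f ⊛ g ≈ₛ f′ ⊛ g
  ⊛-congʳ g e = ⊛-cong e (λ _ → refl)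

  ⊕-cong : {f f′ g g′ : Series} → f ≈ₛ f′ → g ≈ₛ g′ → f ⊕ g ≈ₛ f′ ⊕ g′
  ⊕-cong ef eg n = cong₂ _+_ (ef n) (eg n)

  ⊕-congˡ : (f : Series) {g g′ : Series} → g ≈ₛ g′ → f ⊕ g ≈ₛ f ⊕ g′
  ⊕-congˡ f = ⊕-cong {f} (λ _ → refl)

  ⊕-congʳ : (g : Series) {f f′ : Series} → f ≈ₛ f′ → f ⊕ g ≈ₛ f′ ⊕ g
  ⊕-congʳ g e = ⊕-cong e (λ _ → refl)

  ⊛-distribʳ : (f g h : Series) → (f ⊕ g) ⊛ h ≈ₛ (f ⊛ h) ⊕ (g ⊛ h)
  ⊛-distribʳ f g h n = trans (sumMap-cong (λ i → *-distribʳ-+ (h (n ∸ i)) (f i) (g i)) (upTo (suc n)))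
    (sumMap-+ (λ i → f i * h (n ∸ i)) (λ i → g i * h (n ∸ i)) (upTo (suc n)))

  ⊛-zeroˡ : (f : Series) → 0ₛ ⊛ f ≈ₛ 0ₛ
  ⊛-zeroˡ f n = sumMap-zero (upTo (suc n))

  ⊛-·ₛ : (a : ℕ) (f g : Series) → (a ·ₛ f) ⊛ g ≈ₛ a ·ₛ (f ⊛ g)
  ⊛-·ₛ a f g n = trans (sumMap-cong (λ i → *-assoc a (f i) (g (n ∸ i))) (upTo (suc n)))
    (sumMap-*ˡ a (λ i → f i * g (n ∸ i)) (upTo (suc n)))

  ⊛-identityˡ : (f : Series) → 1ₛ ⊛ f ≈ₛ f
  ⊛-identityˡ f zero = trans (+-identityʳ _) (+-identityʳ (f 0))
  ⊛-identityˡ f (suc n) =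
    trans (⊛-suc 1ₛ f n) (trans (cong₂ _+_ (+-identityʳ (f (suc n))) (⊛-zeroˡ f n)) (+-identityʳ _))

  ⊛-comm : (f g : Series) → f ⊛ g ≈ₛ g ⊛ f
  ⊛-comm f g zero = cong (_+ 0) (*-comm (f 0) (g 0))
  ⊛-comm f g (suc zero) = swap (f 0) (g 1) (f 1) (g 0)
    where
    swap : ∀ a b c d → a * b + (c * d + 0) ≡ d * c + (b * a + 0)
    swap = solveℕ 4 (λ a b c d → a :* b :+ (c :* d :+ con 0) := d :* c :+ (b :* a :+ con 0)) refl
  ⊛-comm f g (suc (suc m)) = begin
    (f ⊛ g) (2 + m)
      ≡⟨ ⊛-suc f g (suc m) ⟩
    f 0 * g (2 + m) + (tail f ⊛ g) (suc m)
      ≡⟨ cong (f 0 * g (2 + m) +_) (trans (⊛-comm (tail f) g (suc m)) (⊛-suc g (tail f) m)) ⟩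
    f 0 * g (2 + m) + (g 0 * f (2 + m) + (tail g ⊛ tail f) m)
      ≡⟨ cong (λ x → f 0 * g (2 + m) + (g 0 * f (2 + m) + x)) (⊛-comm (tail g) (tail f) m) ⟩
    f 0 * g (2 + m) + (g 0 * f (2 + m) + (tail f ⊛ tail g) m)
      ≡⟨ x∙yz≈y∙xz (f 0 * g (2 + m)) (g 0 * f (2 + m)) ((tail f ⊛ tail g) m) ⟩
    g 0 * f (2 + m) + (f 0 * g (2 + m) + (tail f ⊛ tail g) m)
      ≡⟨ cong (g 0 * f (2 + m) +_) (trans (sym (⊛-suc f (tail g) m)) (⊛-comm f (tail g) (suc m))) ⟩
    g 0 * f (2 + m) + (tail g ⊛ f) (suc m)
      ≡⟨ ⊛-suc g f (suc m) ⟨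
    (g ⊛ f) (2 + m)
      ∎
    where
    open ≡-Reasoning
    open import Algebra.Properties.CommutativeSemigroup +-commutativeSemigroup using (x∙yz≈y∙xz)

  ⊛-assoc : (f g h : Series) → (f ⊛ g) ⊛ h ≈ₛ f ⊛ (g ⊛ h)
  ⊛-assoc f g h zero = reassoc (f 0) (g 0) (h 0)
    where
    reassoc : ∀ a b c → (a * b + 0) * c + 0 ≡ a * (b * c + 0) + 0
    reassoc = solveℕ 3 (λ a b c → (a :* b :+ con 0) :* c :+ con 0 := a :* (b :* c :+ con 0) :+ con 0) refl
  ⊛-assoc f g h (suc n) = begin
    ((f ⊛ g) ⊛ h) (suc n)
      ≡⟨ ⊛-suc (f ⊛ g) h n ⟩
    (f 0 * g 0 + 0) * h (suc n) + (tail (f ⊛ g) ⊛ h) n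
      ≡⟨ cong ((f 0 * g 0 + 0) * h (suc n) +_) (⊛-congʳ h (⊛-suc f g) n) ⟩
    (f 0 * g 0 + 0) * h (suc n) + (((f 0 ·ₛ tail g) ⊕ (tail f ⊛ g)) ⊛ h) n
      ≡⟨ cong ((f 0 * g 0 + 0) * h (suc n) +_) (⊛-distribʳ (f 0 ·ₛ tail g) (tail f ⊛ g) h n) ⟩
    (f 0 * g 0 + 0) * h (suc n) + (((f 0 ·ₛ tail g) ⊛ h) n + ((tail f ⊛ g) ⊛ h) n)
      ≡⟨ cong ((f 0 * g 0 + 0) * h (suc n) +_) (cong₂ _+_ (⊛-·ₛ (f 0) (tail g) h n) (⊛-assoc (tail f) g h n)) ⟩
    (f 0 * g 0 + 0) * h (suc n) + (f 0 * (tail g ⊛ h) n + (tail f ⊛ (g ⊛ h)) n)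
      ≡⟨ regroup (f 0) (g 0) (h (suc n)) ((tail g ⊛ h) n) ((tail f ⊛ (g ⊛ h)) n) ⟩
    f 0 * (g 0 * h (suc n) + (tail g ⊛ h) n) + (tail f ⊛ (g ⊛ h)) n
      ≡⟨ cong (λ x → f 0 * x + (tail f ⊛ (g ⊛ h)) n) (sym (⊛-suc g h n)) ⟩
    f 0 * (g ⊛ h) (suc n) + (tail f ⊛ (g ⊛ h)) n
      ≡⟨ ⊛-suc f (g ⊛ h) n ⟨
    (f ⊛ (g ⊛ h)) (suc n)
      ∎
    where
    open ≡-Reasoning
    regroup : ∀ a b c x y → (a * b + 0) * c + (a * x + y) ≡ a * (b * c + x) + y
    regroup = solveℕ 5 (λ a b c x y → (a :* b :+ con 0) :* c :+ (a :* x :+ y) := a :* (b :* c :+ x) :+ y) refl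

  ≈ₛ-isEquivalence : IsEquivalence _≈ₛ_
  ≈ₛ-isEquivalence = record
    { refl = λ _ → refl ; sym = λ e n → sym (e n) ; trans = λ e e′ n → trans (e n) (e′ n) }

  ⊕-isCommutativeMonoid : IsCommutativeMonoid _≈ₛ_ _⊕_ 0ₛ
  ⊕-isCommutativeMonoid = record
    { isMonoid = record
      { isSemigroup = record
        { isMagma = record { isEquivalence = ≈ₛ-isEquivalence ; ∙-cong = ⊕-cong }
        ; assoc = λ f g h n → +-assoc (f n) (g n) (h n) }
      ; identity = (λ f n → refl) , (λ f n → +-identityʳ (f n)) }
    ; comm = λ f g n → +-comm (f n) (g n) }

  ⊛-isCommutativeMonoid : IsCommutativeMonoid _≈ₛ_ _⊛_ 1ₛ
  ⊛-isCommutativeMonoid = record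
    { isMonoid = record
      { isSemigroup = record
        { isMagma = record { isEquivalence = ≈ₛ-isEquivalence ; ∙-cong = ⊛-cong }
        ; assoc = ⊛-assoc }
      ; identity = ⊛-identityˡ , (λ f n → trans (⊛-comm f 1ₛ n) (⊛-identityˡ f n)) }
    ; comm = ⊛-comm }

  seriesSemiring : CommutativeSemiring _ _
  seriesSemiring = record
    { Carrier = Series ; _≈_ = _≈ₛ_ ; _+_ = _⊕_ ; _*_ = _⊛_ ; 0# = 0ₛ ; 1# = 1ₛ
    ; isCommutativeSemiring = IsCommutativeSemiringˡ.isCommutativeSemiring (record
       { +-isCommutativeMonoid = ⊕-isCommutativeMonoid
       ; *-isCommutativeMonoid = ⊛-isCommutativeMonoid
       ; distribʳ = λ h f g → ⊛-distribʳ f g h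
       ; zeroˡ = ⊛-zeroˡ }) }

  module SeriesSolver = Algebra.Solver.Ring.NaturalCoefficients.Default seriesSemiring

  zₛ⊛-suc : (f : Series) (n : ℕ) → (zₛ ⊛ f) (suc n) ≡ f n
  zₛ⊛-suc f n = trans (⊛-suc zₛ f n) (trans (⊛-congʳ f tail-zₛ n) (⊛-identityˡ f n))
    where
    tail-zₛ : tail zₛ ≈ₛ 1ₛ
    tail-zₛ zero = refl
    tail-zₛ (suc i) = refl

  ⊛-cong-≤ : (n : ℕ) (f g g′ : Series) → (∀ i → i ≤ n → g i ≡ g′ i) → (f ⊛ g) n ≡ (f ⊛ g′) n
  ⊛-cong-≤ zero f g g′ e = cong (λ x → f 0 * x + 0) (e 0 z≤n)
  ⊛-cong-≤ (suc n) f g g′ e = begin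
    (f ⊛ g) (suc n)                      ≡⟨ ⊛-suc f g n ⟩
    f 0 * g (suc n) + (tail f ⊛ g) n     ≡⟨ cong₂ _+_ (cong (f 0 *_) (e (suc n) ≤-refl))
                                                      (⊛-cong-≤ n (tail f) g g′ (λ i i≤n → e i (m≤n⇒m≤1+n i≤n))) ⟩
    f 0 * g′ (suc n) + (tail f ⊛ g′) n   ≡⟨ ⊛-suc f g′ n ⟨
    (f ⊛ g′) (suc n)                     ∎
    where open ≡-Reasoning

  -- Coefficient n of the right-hand side only involves Y 0, …, Y (n - 1).
  fixpoint-unique : (A K Y Y′ : Series) → Y ≈ₛ A ⊕ zₛ ⊛ (K ⊛ Y) → Y′ ≈ₛ A ⊕ zₛ ⊛ (K ⊛ Y′) → Y ≈ₛ Y′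
  fixpoint-unique A K Y Y′ eY eY′ n = below n n ≤-refl
    where
    below : (m i : ℕ) → i ≤ m → Y i ≡ Y′ i
    below zero zero _ = trans (eY 0) (sym (eY′ 0))
    below (suc m) i i≤ with m≤n⇒m<n∨m≡n i≤
    ... | inj₁ i<1+m = below m i (≤-pred i<1+m)
    ... | inj₂ refl = begin
      Y (suc m)                              ≡⟨ eY (suc m) ⟩
      A (suc m) + (zₛ ⊛ (K ⊛ Y)) (suc m)     ≡⟨ cong (A (suc m) +_) (zₛ⊛-suc (K ⊛ Y) m) ⟩
      A (suc m) + (K ⊛ Y) m                  ≡⟨ cong (A (suc m) +_) (⊛-cong-≤ m K Y Y′ (below m)) ⟩
      A (suc m) + (K ⊛ Y′) m                 ≡⟨ cong (A (suc m) +_) (zₛ⊛-suc (K ⊛ Y′) m) ⟨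
      A (suc m) + (zₛ ⊛ (K ⊛ Y′)) (suc m)    ≡⟨ eY′ (suc m) ⟨
      Y′ (suc m)                             ∎
      where open ≡-Reasoning

module EulerOperator where

  open PowerSeries
  open import Data.Nat using (zero; suc; _+_; _*_)
  open import Data.Nat.Properties using (*-distribˡ-+; *-zeroʳ; +-comm)
  open import Data.Nat.Solver using (module +-*-Solver)
  open +-*-Solver using (_:+_; _:*_; _:=_; con) renaming (solve to solveℕ)
  open import Relation.Binary.PropositionalEquality

  -- The operator z d/dz, acting on coefficients.
  Dₛ : Series → Series
  Dₛ f n = n * f n

  Dₛ-cong : {f g : Series} → f ≈ₛ g → Dₛ f ≈ₛ Dₛ g
  Dₛ-cong e n = cong (n *_) (e n)

  Dₛ-⊕ : (f g : Series) → Dₛ (f ⊕ g) ≈ₛ Dₛ f ⊕ Dₛ g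
  Dₛ-⊕ f g n = *-distribˡ-+ n (f n) (g n)

  Dₛ-1ₛ : Dₛ 1ₛ ≈ₛ 0ₛ
  Dₛ-1ₛ zero = refl
  Dₛ-1ₛ (suc n) = *-zeroʳ (suc n)

  Dₛ-zₛ : Dₛ zₛ ≈ₛ zₛ
  Dₛ-zₛ zero = refl
  Dₛ-zₛ (suc zero) = refl
  Dₛ-zₛ (suc (suc n)) = *-zeroʳ (suc (suc n))

  tail-Dₛ : (f : Series) → tail (Dₛ f) ≈ₛ Dₛ (tail f) ⊕ tail f
  tail-Dₛ f n = +-comm (f (suc n)) (n * f (suc n))

  Dₛ-⊛ : (f g : Series) → Dₛ (f ⊛ g) ≈ₛ (Dₛ f ⊛ g) ⊕ (f ⊛ Dₛ g)
  Dₛ-⊛ f g zero = cong (_+ 0) (sym (*-zeroʳ (f 0)))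
  Dₛ-⊛ f g (suc n) = begin
    suc n * (f ⊛ g) (suc n)
      ≡⟨ cong (suc n *_) (⊛-suc f g n) ⟩
    suc n * (f 0 * g (suc n) + X)
      ≡⟨ expand (f 0) (g (suc n)) X n ⟩
    (n * X + X) + f 0 * (suc n * g (suc n))
      ≡⟨ cong (λ y → (y + X) + f 0 * (suc n * g (suc n))) (Dₛ-⊛ (tail f) g n) ⟩
    ((Dₛ (tail f) ⊛ g) n + (tail f ⊛ Dₛ g) n + X) + f 0 * (suc n * g (suc n))
      ≡⟨ regroup ((Dₛ (tail f) ⊛ g) n) ((tail f ⊛ Dₛ g) n) X (f 0 * (suc n * g (suc n))) ⟩
    ((Dₛ (tail f) ⊛ g) n + X) + (f 0 * (suc n * g (suc n)) + (tail f ⊛ Dₛ g) n)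
      ≡⟨ cong₂ _+_ (sym (⊛-distribʳ (Dₛ (tail f)) (tail f) g n)) (sym (⊛-suc f (Dₛ g) n)) ⟩
    ((Dₛ (tail f) ⊕ tail f) ⊛ g) n + (f ⊛ Dₛ g) (suc n)
      ≡⟨ cong (_+ (f ⊛ Dₛ g) (suc n)) (sym (⊛-congʳ g (tail-Dₛ f) n)) ⟩
    (tail (Dₛ f) ⊛ g) n + (f ⊛ Dₛ g) (suc n)
      ≡⟨ cong (_+ (f ⊛ Dₛ g) (suc n)) (sym (⊛-suc (Dₛ f) g n)) ⟩
    (Dₛ f ⊛ g) (suc n) + (f ⊛ Dₛ g) (suc n)
      ∎
    where
    open ≡-Reasoning
    X = (tail f ⊛ g) n
    expand : ∀ a b x m → suc m * (a * b + x) ≡ (m * x + x) + a * (suc m * b)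
    expand = solveℕ 4 (λ a b x m → (con 1 :+ m) :* (a :* b :+ x) := (m :* x :+ x) :+ a :* ((con 1 :+ m) :* b)) refl
    regroup : ∀ a b c d → (a + b + c) + d ≡ (a + c) + (d + b)
    regroup = solveℕ 4 (λ a b c d → (a :+ b :+ c) :+ d := (a :+ c) :+ (d :+ b)) refl

module CentralBinomial where

  open import Data.Nat using (zero; suc; _+_; _*_; _∸_; _≤_; _!)
  open import Data.Nat.Properties
  open import Data.Nat.Combinatorics using (_C_; k![n∸k]!∣n!)
  open import Data.Nat.Combinatorics.Specification using (nCk≡n!/k![n-k]!)
  open import Data.Nat.DivMod using (m/n*n≡m)
  open import Data.Nat.Solver using (module +-*-Solver)
  open +-*-Solver using (_:+_; _:*_; _:=_; con) renaming (solve to solveℕ)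
  open import Relation.Binary.PropositionalEquality

  nCk*k!*[n∸k]!≡n! : ∀ {n k} → k ≤ n → (n C k) * (k ! * (n ∸ k) !) ≡ n !
  nCk*k!*[n∸k]!≡n! {n} {k} k≤n = trans (cong (_* (k ! * (n ∸ k) !)) (nCk≡n!/k![n-k]! k≤n))
    (m/n*n≡m {{k !* (n ∸ k) !≢0}} (k![n∸k]!∣n! k≤n))

  [2n]Cn*n!*n!≡[2n]! : ∀ n → ((2 * n) C n) * (n ! * n !) ≡ (2 * n) !
  [2n]Cn*n!*n!≡[2n]! n = subst (λ k → ((2 * n) C n) * (n ! * k !) ≡ (2 * n) !) 2n∸n≡n
    (nCk*k!*[n∸k]!≡n! (m≤m+n n (n + 0)))
    where
    2n∸n≡n : 2 * n ∸ n ≡ n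
    2n∸n≡n = trans (cong (λ k → n + k ∸ n) (+-identityʳ n)) (m+n∸m≡n n n)

  Bser-rec : ∀ n → suc n * Bser (suc n) ≡ (2 + 4 * n) * Bser n
  Bser-rec n = *-cancelˡ-≡ _ _ (suc n) (*-cancelʳ-≡ _ _ (n ! * n !) {{n !* n !≢0}} scaled)
    where
    open ≡-Reasoning
    scaled : suc n * (suc n * Bser (suc n)) * (n ! * n !) ≡ suc n * ((2 + 4 * n) * Bser n) * (n ! * n !)
    scaled = begin
      suc n * (suc n * Bser (suc n)) * (n ! * n !)
        ≡⟨ solveℕ 3 (λ m x f → (con 1 :+ m) :* ((con 1 :+ m) :* x) :* (f :* f)
                               := x :* (((con 1 :+ m) :* f) :* ((con 1 :+ m) :* f))) refl n (Bser (suc n)) (n !) ⟩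
      Bser (suc n) * (suc n ! * suc n !)
        ≡⟨ [2n]Cn*n!*n!≡[2n]! (suc n) ⟩
      (2 * suc n) !
        ≡⟨ cong (λ k → suc k !) (+-suc n (n + 0)) ⟩
      suc (suc (2 * n)) * (suc (2 * n) * (2 * n) !)
        ≡⟨ cong (λ y → suc (suc (2 * n)) * (suc (2 * n) * y)) (sym ([2n]Cn*n!*n!≡[2n]! n)) ⟩
      suc (suc (2 * n)) * (suc (2 * n) * (Bser n * (n ! * n !)))
        ≡⟨ solveℕ 3 (λ m x f → (con 2 :+ (con 2 :* m)) :* ((con 1 :+ con 2 :* m) :* (x :* (f :* f)))
                               := (con 1 :+ m) :* ((con 2 :+ con 4 :* m) :* x) :* (f :* f)) refl n (Bser n) (n !) ⟩
      suc n * ((2 + 4 * n) * Bser n) * (n ! * n !)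
        ∎

  ≡Bser-by-rec : (u : Series) → u 0 ≡ 1 → (∀ n → suc n * u (suc n) ≡ (2 + 4 * n) * u n) → ∀ n → u n ≡ Bser n
  ≡Bser-by-rec u u0 u-rec zero = u0
  ≡Bser-by-rec u u0 u-rec (suc n) = *-cancelˡ-≡ (u (suc n)) (Bser (suc n)) (suc n)
    (trans (u-rec n) (trans (cong ((2 + 4 * n) *_) (≡Bser-by-rec u u0 u-rec n)) (sym (Bser-rec n))))

module CatalanSystem where

  open PowerSeries
  open EulerOperator
  open CentralBinomial using (≡Bser-by-rec)
  open import Data.Nat using (zero; suc; _+_; _*_; _/_)
  open import Data.Nat.Properties using (+-identityʳ)
  open import Data.Nat.DivMod using (m*n/n≡m)
  open import Data.Nat.Solver using (module +-*-Solver)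
  open +-*-Solver using () renaming (solve to solveℕ; _:+_ to _:+ℕ_; _:*_ to _:*ℕ_; _:=_ to _:=ℕ_; con to conℕ)
  open SeriesSolver using (solve; _:+_; _:*_; _:=_; con)
  open import Algebra.Bundles using (CommutativeSemiring)
  open CommutativeSemiring seriesSemiring using (setoid; refl; sym)
  open import Relation.Binary.Reasoning.Setoid setoid
  import Relation.Binary.PropositionalEquality as ≡
  module ℕR = ≡.≡-Reasoning

  z³·≈zₛ⊛zₛ⊛zₛ⊛ : (f : Series) → z³· f ≈ₛ zₛ ⊛ (zₛ ⊛ (zₛ ⊛ f))
  z³·≈zₛ⊛zₛ⊛zₛ⊛ f zero = ≡.refl
  z³·≈zₛ⊛zₛ⊛zₛ⊛ f (suc zero) = ≡.sym (zₛ⊛-suc (zₛ ⊛ (zₛ ⊛ f)) 0)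
  z³·≈zₛ⊛zₛ⊛zₛ⊛ f (suc (suc zero)) = ≡.sym (≡.trans (zₛ⊛-suc (zₛ ⊛ (zₛ ⊛ f)) 1) (zₛ⊛-suc (zₛ ⊛ f) 0))
  z³·≈zₛ⊛zₛ⊛zₛ⊛ f (suc (suc (suc m))) =
    ≡.sym (≡.trans (zₛ⊛-suc (zₛ ⊛ (zₛ ⊛ f)) (2 + m)) (≡.trans (zₛ⊛-suc (zₛ ⊛ f) (suc m)) (zₛ⊛-suc f m)))

  ^ˢ-zero : (f : Series) → f ^ˢ 0 ≈ₛ 1ₛ
  ^ˢ-zero f zero = ≡.refl
  ^ˢ-zero f (suc n) = ≡.refl

  module _
    (c p t : Series)
    (c-eq : c ≈ₛ 1ₛ ⊕ zₛ ⊛ (c ⊛ c))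
    (p-eq : p ≈ₛ zₛ ⊛ ((c ⊛ Dₛ c) ⊕ (p ⊛ c) ⊕ (c ⊛ p) ⊕ (Dₛ c ⊛ Dₛ c)))
    (t-eq : t ≈ₛ zₛ ⊛ ((c ⊛ p) ⊕ (t ⊛ c) ⊕ (c ⊛ t) ⊕ (p ⊛ Dₛ c) ⊕ (Dₛ c ⊛ p)))
    where

    b : Series
    b = c ⊕ Dₛ c

    Dc-eq : Dₛ c ≈ₛ zₛ ⊛ (c ⊛ c) ⊕ zₛ ⊛ ((c ⊕ c) ⊛ Dₛ c)
    Dc-eq = begin
      Dₛ c
        ≈⟨ Dₛ-cong c-eq ⟩
      Dₛ (1ₛ ⊕ zₛ ⊛ (c ⊛ c))
        ≈⟨ Dₛ-⊕ 1ₛ (zₛ ⊛ (c ⊛ c)) ⟩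
      Dₛ 1ₛ ⊕ Dₛ (zₛ ⊛ (c ⊛ c))
        ≈⟨ ⊕-cong Dₛ-1ₛ (Dₛ-⊛ zₛ (c ⊛ c)) ⟩
      0ₛ ⊕ ((Dₛ zₛ ⊛ (c ⊛ c)) ⊕ (zₛ ⊛ Dₛ (c ⊛ c)))
        ≈⟨ ⊕-congˡ 0ₛ (⊕-cong (⊛-congʳ (c ⊛ c) Dₛ-zₛ) (⊛-congˡ zₛ (Dₛ-⊛ c c))) ⟩
      0ₛ ⊕ ((zₛ ⊛ (c ⊛ c)) ⊕ (zₛ ⊛ ((Dₛ c ⊛ c) ⊕ (c ⊛ Dₛ c))))
        ≈⟨ solve 3 (λ z c d → con 0 :+ (z :* (c :* c) :+ z :* (d :* c :+ c :* d))
                             := z :* (c :* c) :+ z :* ((c :+ c) :* d)) refl zₛ c (Dₛ c) ⟩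
      zₛ ⊛ (c ⊛ c) ⊕ zₛ ⊛ ((c ⊕ c) ⊛ Dₛ c)
        ∎

    b-eq : b ≈ₛ 1ₛ ⊕ zₛ ⊛ ((c ⊕ c) ⊛ b)
    b-eq = begin
      b
        ≈⟨ ⊕-cong c-eq Dc-eq ⟩
      (1ₛ ⊕ zₛ ⊛ (c ⊛ c)) ⊕ (zₛ ⊛ (c ⊛ c) ⊕ zₛ ⊛ ((c ⊕ c) ⊛ Dₛ c))
        ≈⟨ solve 3 (λ z c d → (con 1 :+ z :* (c :* c)) :+ (z :* (c :* c) :+ z :* ((c :+ c) :* d))
                             := con 1 :+ z :* ((c :+ c) :* (c :+ d))) refl zₛ c (Dₛ c) ⟩
      1ₛ ⊕ zₛ ⊛ ((c ⊕ c) ⊛ b)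
        ∎

    Dc≈zbc² : Dₛ c ≈ₛ zₛ ⊛ (b ⊛ (c ⊛ c))
    Dc≈zbc² = fixpoint-unique (zₛ ⊛ (c ⊛ c)) (c ⊕ c) (Dₛ c) W Dc-eq W-eq
      where
      W = zₛ ⊛ (b ⊛ (c ⊛ c))
      W-eq : W ≈ₛ zₛ ⊛ (c ⊛ c) ⊕ zₛ ⊛ ((c ⊕ c) ⊛ W)
      W-eq = begin
        zₛ ⊛ (b ⊛ (c ⊛ c))
          ≈⟨ ⊛-congˡ zₛ (⊛-congʳ (c ⊛ c) b-eq) ⟩
        zₛ ⊛ ((1ₛ ⊕ zₛ ⊛ ((c ⊕ c) ⊛ b)) ⊛ (c ⊛ c))
          ≈⟨ solve 3 (λ z b c → z :* ((con 1 :+ z :* ((c :+ c) :* b)) :* (c :* c))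
                               := z :* (c :* c) :+ z :* ((c :+ c) :* (z :* (b :* (c :* c))))) refl zₛ b c ⟩
        zₛ ⊛ (c ⊛ c) ⊕ zₛ ⊛ ((c ⊕ c) ⊛ W)
          ∎

    p≈z²b³c² : p ≈ₛ zₛ ⊛ (zₛ ⊛ (b ⊛ (b ⊛ (b ⊛ (c ⊛ c)))))
    p≈z²b³c² = fixpoint-unique A (c ⊕ c) p Q p-fix Q-fix
      where
      d = Dₛ c
      A = zₛ ⊛ ((c ⊛ d) ⊕ (d ⊛ d))
      Q = zₛ ⊛ (zₛ ⊛ (b ⊛ (b ⊛ (b ⊛ (c ⊛ c)))))
      W = zₛ ⊛ (b ⊛ (c ⊛ c))
      Q≈zWbb : Q ≈ₛ zₛ ⊛ ((W ⊛ b) ⊛ b)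
      Q≈zWbb = solve 3 (λ z b c → z :* (z :* (b :* (b :* (b :* (c :* c))))) := z :* ((z :* (b :* (c :* c)) :* b) :* b))
                 refl zₛ b c
      p-fix : p ≈ₛ A ⊕ zₛ ⊛ ((c ⊕ c) ⊛ p)
      p-fix = begin
        p
          ≈⟨ p-eq ⟩
        zₛ ⊛ ((c ⊛ d) ⊕ (p ⊛ c) ⊕ (c ⊛ p) ⊕ (d ⊛ d))
          ≈⟨ solve 4 (λ z c d p → z :* (c :* d :+ p :* c :+ c :* p :+ d :* d)
                                 := z :* (c :* d :+ d :* d) :+ z :* ((c :+ c) :* p)) refl zₛ c d p ⟩
        A ⊕ zₛ ⊛ ((c ⊕ c) ⊛ p)
          ∎
      Q-fix : Q ≈ₛ A ⊕ zₛ ⊛ ((c ⊕ c) ⊛ Q)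
      Q-fix = begin
        Q
          ≈⟨ Q≈zWbb ⟩
        zₛ ⊛ ((W ⊛ b) ⊛ b)
          ≈⟨ ⊛-congˡ zₛ (⊛-congˡ (W ⊛ b) b-eq) ⟩
        zₛ ⊛ ((W ⊛ b) ⊛ (1ₛ ⊕ zₛ ⊛ ((c ⊕ c) ⊛ b)))
          ≈⟨ solve 4 (λ z b c w → z :* ((w :* b) :* (con 1 :+ z :* ((c :+ c) :* b)))
                                 := z :* (w :* b) :+ z :* ((c :+ c) :* (z :* (w :* b :* b)))) refl zₛ b c W ⟩
        zₛ ⊛ (W ⊛ b) ⊕ zₛ ⊛ ((c ⊕ c) ⊛ (zₛ ⊛ ((W ⊛ b) ⊛ b)))
          ≈⟨ ⊕-cong (⊛-congˡ zₛ (⊛-congʳ b (sym Dc≈zbc²))) (⊛-congˡ zₛ (⊛-congˡ (c ⊕ c) (sym Q≈zWbb))) ⟩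
        zₛ ⊛ (d ⊛ (c ⊕ d)) ⊕ zₛ ⊛ ((c ⊕ c) ⊛ Q)
          ≈⟨ solve 4 (λ z c d q → z :* (d :* (c :+ d)) :+ z :* ((c :+ c) :* q)
                                 := z :* (c :* d :+ d :* d) :+ z :* ((c :+ c) :* q)) refl zₛ c d Q ⟩
        A ⊕ zₛ ⊛ ((c ⊕ c) ⊛ Q)
          ∎

    t≈z³b⁵c³ : t ≈ₛ zₛ ⊛ (zₛ ⊛ (zₛ ⊛ (b ⊛ (b ⊛ (b ⊛ (b ⊛ (b ⊛ (c ⊛ (c ⊛ c)))))))))
    t≈z³b⁵c³ = fixpoint-unique A (c ⊕ c) t Q t-fix Q-fix
      where
      d = Dₛ c
      A = zₛ ⊛ ((c ⊛ p) ⊕ (p ⊛ d) ⊕ (d ⊛ p))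
      Q = zₛ ⊛ (zₛ ⊛ (zₛ ⊛ (b ⊛ (b ⊛ (b ⊛ (b ⊛ (b ⊛ (c ⊛ (c ⊛ c)))))))))
      P = zₛ ⊛ (zₛ ⊛ (b ⊛ (b ⊛ (b ⊛ (c ⊛ c)))))
      W = zₛ ⊛ (b ⊛ (c ⊛ c))
      Q≈zPcbb : Q ≈ₛ zₛ ⊛ (((P ⊛ c) ⊛ b) ⊛ b)
      Q≈zPcbb = solve 3 (λ z b c → z :* (z :* (z :* (b :* (b :* (b :* (b :* (b :* (c :* (c :* c)))))))))
                                  := z :* (z :* (z :* (b :* (b :* (b :* (c :* c))))) :* c :* b :* b)) refl zₛ b c
      t-fix : t ≈ₛ A ⊕ zₛ ⊛ ((c ⊕ c) ⊛ t)
      t-fix = begin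
        t
          ≈⟨ t-eq ⟩
        zₛ ⊛ ((c ⊛ p) ⊕ (t ⊛ c) ⊕ (c ⊛ t) ⊕ (p ⊛ d) ⊕ (d ⊛ p))
          ≈⟨ solve 5 (λ z c d p t → z :* (c :* p :+ t :* c :+ c :* t :+ p :* d :+ d :* p)
                                   := z :* (c :* p :+ p :* d :+ d :* p) :+ z :* ((c :+ c) :* t)) refl zₛ c d p t ⟩
        A ⊕ zₛ ⊛ ((c ⊕ c) ⊛ t)
          ∎
      Q-fix : Q ≈ₛ A ⊕ zₛ ⊛ ((c ⊕ c) ⊛ Q)
      Q-fix = begin
        Q
          ≈⟨ Q≈zPcbb ⟩
        zₛ ⊛ (((P ⊛ c) ⊛ b) ⊛ b)
          ≈⟨ ⊛-congˡ zₛ (⊛-congˡ ((P ⊛ c) ⊛ b) b-eq) ⟩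
        zₛ ⊛ (((P ⊛ c) ⊛ b) ⊛ (1ₛ ⊕ zₛ ⊛ ((c ⊕ c) ⊛ b)))
          ≈⟨ solve 4 (λ z b c p → z :* ((p :* c :* b) :* (con 1 :+ z :* ((c :+ c) :* b)))
                                 := z :* (p :* c :* b) :+ z :* ((c :+ c) :* (z :* (p :* c :* b :* b)))) refl zₛ b c P ⟩
        zₛ ⊛ ((P ⊛ c) ⊛ b) ⊕ zₛ ⊛ ((c ⊕ c) ⊛ (zₛ ⊛ (((P ⊛ c) ⊛ b) ⊛ b)))
          ≈⟨ ⊕-cong (⊛-congˡ zₛ (⊛-congˡ (P ⊛ c) b-eq)) (⊛-congˡ zₛ (⊛-congˡ (c ⊕ c) (sym Q≈zPcbb))) ⟩
        zₛ ⊛ ((P ⊛ c) ⊛ (1ₛ ⊕ zₛ ⊛ ((c ⊕ c) ⊛ b))) ⊕ zₛ ⊛ ((c ⊕ c) ⊛ Q)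
          ≈⟨ solve 5 (λ z b c p q → z :* ((p :* c) :* (con 1 :+ z :* ((c :+ c) :* b))) :+ z :* ((c :+ c) :* q)
                                   := z :* (c :* p :+ p :* (z :* (b :* (c :* c))) :+ z :* (b :* (c :* c)) :* p)
                                      :+ z :* ((c :+ c) :* q)) refl zₛ b c P Q ⟩
        zₛ ⊛ ((c ⊛ P) ⊕ (P ⊛ W) ⊕ (W ⊛ P)) ⊕ zₛ ⊛ ((c ⊕ c) ⊛ Q)
          ≈⟨ ⊕-congʳ (zₛ ⊛ ((c ⊕ c) ⊛ Q)) (⊛-congˡ zₛ (⊕-cong (⊕-cong (⊛-congˡ c (sym p≈z²b³c²))
               (⊛-cong (sym p≈z²b³c²) (sym Dc≈zbc²))) (⊛-cong (sym Dc≈zbc²) (sym p≈z²b³c²)))) ⟩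
        A ⊕ zₛ ⊛ ((c ⊕ c) ⊛ Q)
          ∎

    b-eq₂ : b ≈ₛ 1ₛ ⊕ zₛ ⊛ ((c ⊕ c) ⊕ (Dₛ c ⊕ Dₛ c ⊕ Dₛ c ⊕ Dₛ c))
    b-eq₂ = begin
      b
        ≈⟨ b-eq ⟩
      1ₛ ⊕ zₛ ⊛ ((c ⊕ c) ⊛ b)
        ≈⟨ ⊕-congˡ 1ₛ (⊛-congˡ zₛ (⊛-congˡ (c ⊕ c) b-eq)) ⟩
      1ₛ ⊕ zₛ ⊛ ((c ⊕ c) ⊛ (1ₛ ⊕ zₛ ⊛ ((c ⊕ c) ⊛ b)))
        ≈⟨ solve 3 (λ z b c → con 1 :+ z :* ((c :+ c) :* (con 1 :+ z :* ((c :+ c) :* b)))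
                             := con 1 :+ z :* ((c :+ c) :+ (W′ z b c :+ W′ z b c :+ W′ z b c :+ W′ z b c))) refl zₛ b c ⟩
      1ₛ ⊕ zₛ ⊛ ((c ⊕ c) ⊕ (W ⊕ W ⊕ W ⊕ W))
        ≈⟨ ⊕-congˡ 1ₛ (⊛-congˡ zₛ (⊕-congˡ (c ⊕ c) (⊕-cong (⊕-cong (⊕-cong W≈Dc W≈Dc) W≈Dc) W≈Dc))) ⟩
      1ₛ ⊕ zₛ ⊛ ((c ⊕ c) ⊕ (Dₛ c ⊕ Dₛ c ⊕ Dₛ c ⊕ Dₛ c))
        ∎
      where
      W = zₛ ⊛ (b ⊛ (c ⊛ c))
      W′ = λ z b c → z :* (b :* (c :* c))
      W≈Dc = sym Dc≈zbc²

    b-rec : ∀ n → suc n * b (suc n) ≡ (2 + 4 * n) * b n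
    b-rec n = ℕR.begin
      suc n * b (suc n)
        ℕR.≡⟨ ≡.cong (suc n *_) (≡.trans (b-eq₂ (suc n)) (zₛ⊛-suc ((c ⊕ c) ⊕ (Dₛ c ⊕ Dₛ c ⊕ Dₛ c ⊕ Dₛ c)) n)) ⟩
      suc n * (c n + c n + (n * c n + n * c n + n * c n + n * c n))
        ℕR.≡⟨ solveℕ 2 (λ m x → (conℕ 1 :+ℕ m) :*ℕ (x :+ℕ x :+ℕ (m :*ℕ x :+ℕ m :*ℕ x :+ℕ m :*ℕ x :+ℕ m :*ℕ x))
                               :=ℕ (conℕ 2 :+ℕ conℕ 4 :*ℕ m) :*ℕ (x :+ℕ m :*ℕ x)) ≡.refl n (c n) ⟩
      (2 + 4 * n) * b n
        ℕR.∎

    b≈Bser : b ≈ₛ Bser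
    b≈Bser = ≡Bser-by-rec b (≡.trans (+-identityʳ (c 0)) (c-eq 0)) b-rec

    c≈Cser : c ≈ₛ Cser
    c≈Cser n = ≡.sym (ℕR.begin
      Bser n / suc n
        ℕR.≡⟨ ≡.cong (_/ suc n) (≡.sym (b≈Bser n)) ⟩
      (c n + n * c n) / suc n
        ℕR.≡⟨ ≡.cong (_/ suc n) (solveℕ 2 (λ x m → x :+ℕ m :*ℕ x :=ℕ conℕ 0 :+ℕ x :*ℕ (conℕ 1 :+ℕ m)) ≡.refl (c n) n) ⟩
      c n * suc n / suc n
        ℕR.≡⟨ m*n/n≡m (c n) (suc n) ⟩
      c n
        ℕR.∎)

    t≈z³·B⁵C³ : t ≈ₛ z³· ((Bser ^ˢ 5) ⊛ (Cser ^ˢ 3))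
    t≈z³·B⁵C³ = begin
      t
        ≈⟨ t≈z³b⁵c³ ⟩
      zₛ ⊛ (zₛ ⊛ (zₛ ⊛ (b ⊛ (b ⊛ (b ⊛ (b ⊛ (b ⊛ (c ⊛ (c ⊛ c)))))))))
        ≈⟨ solve 3 (λ z b c → z :* (z :* (z :* (b :* (b :* (b :* (b :* (b :* (c :* (c :* c)))))))))
                             := z :* (z :* (z :* ((b :* (b :* (b :* (b :* (b :* con 1))))) :* (c :* (c :* (c :* con 1))))))) refl zₛ b c ⟩
      zₛ ⊛ (zₛ ⊛ (zₛ ⊛ ((b ⊛ (b ⊛ (b ⊛ (b ⊛ (b ⊛ 1ₛ))))) ⊛ (c ⊛ (c ⊛ (c ⊛ 1ₛ))))))
        ≈⟨ ⊛-congˡ zₛ (⊛-congˡ zₛ (⊛-congˡ zₛ (⊛-cong (b⁵≈B⁵ (sym (^ˢ-zero Bser))) (c³≈C³ (sym (^ˢ-zero Cser)))))) ⟩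
      zₛ ⊛ (zₛ ⊛ (zₛ ⊛ ((Bser ^ˢ 5) ⊛ (Cser ^ˢ 3))))
        ≈⟨ sym (z³·≈zₛ⊛zₛ⊛zₛ⊛ ((Bser ^ˢ 5) ⊛ (Cser ^ˢ 3))) ⟩
      z³· ((Bser ^ˢ 5) ⊛ (Cser ^ˢ 3))
        ∎
      where
      b⁵≈B⁵ : {f g : Series} → f ≈ₛ g → b ⊛ (b ⊛ (b ⊛ (b ⊛ (b ⊛ f)))) ≈ₛ Bser ⊛ (Bser ⊛ (Bser ⊛ (Bser ⊛ (Bser ⊛ g))))
      b⁵≈B⁵ e = ⊛-cong b≈Bser (⊛-cong b≈Bser (⊛-cong b≈Bser (⊛-cong b≈Bser (⊛-cong b≈Bser e))))
      c³≈C³ : {f g : Series} → f ≈ₛ g → c ⊛ (c ⊛ (c ⊛ f)) ≈ₛ Cser ⊛ (Cser ⊛ (Cser ⊛ g))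
      c³≈C³ e = ⊛-cong c≈Cser (⊛-cong c≈Cser (⊛-cong c≈Cser e))

module PatternCounts where

  open import Data.Nat using (ℕ; zero; suc; _+_; _*_; _<_; _≤_; _<ᵇ_; s≤s)
  open import Data.Nat.Properties
  open import Data.Bool using (Bool; true; false; if_then_else_)
  open import Data.List using (List; []; _∷_; _++_; map; length)
  open import Data.List.Relation.Unary.All using (All; []; _∷_)
  import Data.List.Relation.Unary.All as All
  open import Relation.Binary.PropositionalEquality
  open import Data.Nat.Solver using (module +-*-Solver)
  open +-*-Solver using (_:+_; _:*_; _:=_; con) renaming (solve to solveℕ)

  𝟙 : Bool → ℕ
  𝟙 b = if b then 1 else 0

  countWith : (ℕ → Bool) → List ℕ → ℕ
  countWith p [] = 0
  countWith p (y ∷ ys) = 𝟙 (p y) + countWith p ys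

  countAbove countBelow : ℕ → List ℕ → ℕ
  countAbove x = countWith (x <ᵇ_)
  countBelow x = countWith (_<ᵇ x)

  -- count123From x ys counts the occurrences of 1-2-3 in x ∷ ys that start at x;
  -- count231From x ys those of 2-3-1 whose 2 is x.
  count123From : ℕ → List ℕ → ℕ
  count123From x [] = 0
  count123From x (y ∷ ys) = (if x <ᵇ y then countAbove y ys else 0) + count123From x ys

  count231From : ℕ → List ℕ → ℕ
  count231From x [] = 0
  count231From x (y ∷ ys) = (if x <ᵇ y then countBelow x ys else 0) + count231From x ys

  count123 : List ℕ → ℕ
  count123 [] = 0
  count123 (x ∷ xs) = count123From x xs + count123 xs

  count12 : List ℕ → ℕ
  count12 [] = 0
  count12 (x ∷ xs) = countAbove x xs + count12 xs

  count231 : List ℕ → ℕ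
  count231 [] = 0
  count231 (x ∷ xs) = count231From x xs + count231 xs

  <⇒<ᵇ≡true : ∀ {m n} → m < n → (m <ᵇ n) ≡ true
  <⇒<ᵇ≡true {zero} {suc n} _ = refl
  <⇒<ᵇ≡true {suc m} {suc n} (s≤s p) = <⇒<ᵇ≡true p

  ≤⇒<ᵇ≡false : ∀ {m n} → n ≤ m → (m <ᵇ n) ≡ false
  ≤⇒<ᵇ≡false {m} {zero} _ = refl
  ≤⇒<ᵇ≡false {suc m} {suc n} (s≤s p) = ≤⇒<ᵇ≡false p

  +-<ᵇ-cancelʳ : ∀ k a b → (a + k <ᵇ b + k) ≡ (a <ᵇ b)
  +-<ᵇ-cancelʳ k a b rewrite +-comm a k | +-comm b k = go k
    where
    go : ∀ k → (k + a <ᵇ k + b) ≡ (a <ᵇ b)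
    go zero = refl
    go (suc k) = go k

  countAbove-all : ∀ {x} ys → All (x <_) ys → countAbove x ys ≡ length ys
  countAbove-all [] [] = refl
  countAbove-all (y ∷ ys) (p ∷ ps) rewrite <⇒<ᵇ≡true p = cong suc (countAbove-all ys ps)

  countAbove-none : ∀ {x} ys → All (_< x) ys → countAbove x ys ≡ 0
  countAbove-none [] [] = refl
  countAbove-none {x} (y ∷ ys) (p ∷ ps) rewrite ≤⇒<ᵇ≡false {x} {y} (<⇒≤ p) = countAbove-none ys ps

  countBelow-none : ∀ {x} ys → All (x <_) ys → countBelow x ys ≡ 0
  countBelow-none [] [] = refl
  countBelow-none {x} (y ∷ ys) (p ∷ ps) rewrite ≤⇒<ᵇ≡false {y} {x} (<⇒≤ p) = countBelow-none ys ps

  countAbove-++ : ∀ x xs ys → countAbove x (xs ++ ys) ≡ countAbove x xs + countAbove x ys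
  countAbove-++ x [] ys = refl
  countAbove-++ x (y ∷ xs) ys rewrite countAbove-++ x xs ys =
    sym (+-assoc (𝟙 (x <ᵇ y)) (countAbove x xs) (countAbove x ys))

  countBelow-++ : ∀ x xs ys → countBelow x (xs ++ ys) ≡ countBelow x xs + countBelow x ys
  countBelow-++ x [] ys = refl
  countBelow-++ x (y ∷ xs) ys rewrite countBelow-++ x xs ys =
    sym (+-assoc (𝟙 (y <ᵇ x)) (countBelow x xs) (countBelow x ys))

  count123From-all : ∀ {x} ys → All (x <_) ys → count123From x ys ≡ count12 ys
  count123From-all [] [] = refl
  count123From-all (y ∷ ys) (p ∷ ps) rewrite <⇒<ᵇ≡true p = cong (countAbove y ys +_) (count123From-all ys ps)

  count231From-all : ∀ {x} ys → All (x <_) ys → count231From x ys ≡ 0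
  count231From-all [] [] = refl
  count231From-all {x} (y ∷ ys) (p ∷ ps) rewrite <⇒<ᵇ≡true p | countBelow-none ys ps = count231From-all ys ps

  count123From-low-++ : ∀ {x} xs ys → All (_< x) xs → count123From x (xs ++ ys) ≡ count123From x ys
  count123From-low-++ [] ys [] = refl
  count123From-low-++ {x} (y ∷ xs) ys (p ∷ ps) rewrite ≤⇒<ᵇ≡false {x} {y} (<⇒≤ p) = count123From-low-++ xs ys ps

  count231From-low-++ : ∀ {x} xs ys → All (_< x) xs → count231From x (xs ++ ys) ≡ count231From x ys
  count231From-low-++ [] ys [] = refl
  count231From-low-++ {x} (y ∷ xs) ys (p ∷ ps) rewrite ≤⇒<ᵇ≡false {x} {y} (<⇒≤ p) = count231From-low-++ xs ys ps

  module Separated (m : ℕ) where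

    all-above : ∀ {x} ys → x < m → All (m <_) ys → All (x <_) ys
    all-above ys x<m ps = All.map (λ q → <-trans x<m q) ps

    countAbove-separated : ∀ {x} xs ys → x < m → All (m <_) ys → countAbove x (xs ++ ys) ≡ countAbove x xs + length ys
    countAbove-separated xs ys x<m ps =
      trans (countAbove-++ _ xs ys) (cong (countAbove _ xs +_) (countAbove-all ys (all-above ys x<m ps)))

    count123From-separated : ∀ {x} xs ys → x < m → All (_< m) xs → All (m <_) ys →
      count123From x (xs ++ ys) ≡ count123From x xs + countAbove x xs * length ys + count12 ys
    count123From-separated xs ys x<m [] ps = count123From-all ys (all-above ys x<m ps)
    count123From-separated {x} (y ∷ xs) ys x<m (q ∷ qs) ps
      rewrite count123From-separated xs ys x<m qs ps | countAbove-separated xs ys q ps with x <ᵇ y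
    ... | true = solveℕ 5 (λ a b c d e → (a :+ e) :+ (b :+ c :* e :+ d) := a :+ b :+ (con 1 :+ c) :* e :+ d) refl
                   (countAbove y xs) (count123From x xs) (countAbove x xs) (count12 ys) (length ys)
    ... | false = refl

    count12-separated : ∀ xs ys → All (_< m) xs → All (m <_) ys →
      count12 (xs ++ ys) ≡ count12 xs + count12 ys + length xs * length ys
    count12-separated [] ys [] ps = sym (+-identityʳ (count12 ys))
    count12-separated (x ∷ xs) ys (q ∷ qs) ps rewrite count12-separated xs ys qs ps | countAbove-separated xs ys q ps =
      solveℕ 5 (λ a b c d e → (a :+ e) :+ (b :+ c :+ d :* e) := a :+ b :+ c :+ (con 1 :+ d) :* e) refl
        (countAbove x xs) (count12 xs) (count12 ys) (length xs) (length ys)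

    count123-separated : ∀ xs ys → All (_< m) xs → All (m <_) ys →
      count123 (xs ++ ys) ≡ count123 xs + count123 ys + count12 xs * length ys + length xs * count12 ys
    count123-separated [] ys [] ps = sym (trans (+-identityʳ (count123 ys + 0)) (+-identityʳ (count123 ys)))
    count123-separated (x ∷ xs) ys (q ∷ qs) ps rewrite count123-separated xs ys qs ps | count123From-separated xs ys q qs ps =
      solveℕ 8 (λ a g n₁ n₂ p₁ p₂ l₁ l₂ → (a :+ g :* l₂ :+ p₂) :+ (n₁ :+ n₂ :+ p₁ :* l₂ :+ l₁ :* p₂)
                                        := (a :+ n₁) :+ n₂ :+ (g :+ p₁) :* l₂ :+ (con 1 :+ l₁) :* p₂)
        refl (count123From x xs) (countAbove x xs) (count123 xs) (count123 ys) (count12 xs) (count12 ys) (length xs) (length ys)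

    count231From-separated : ∀ {x} xs ys → x < m → All (_< m) xs → All (m <_) ys →
      count231From x (xs ++ ys) ≡ count231From x xs
    count231From-separated xs ys x<m [] ps = count231From-all ys (all-above ys x<m ps)
    count231From-separated {x} (y ∷ xs) ys x<m (q ∷ qs) ps rewrite count231From-separated xs ys x<m qs ps
      | countBelow-++ x xs ys | countBelow-none ys (all-above ys x<m ps) | +-identityʳ (countBelow x xs) = refl

    count231-separated : ∀ xs ys → All (_< m) xs → All (m <_) ys → count231 (xs ++ ys) ≡ count231 xs + count231 ys
    count231-separated [] ys [] ps = refl
    count231-separated (x ∷ xs) ys (q ∷ qs) ps rewrite count231-separated xs ys qs ps | count231From-separated xs ys q qs ps =
      sym (+-assoc (count231From x xs) (count231 xs) (count231 ys))

  shift : ℕ → List ℕ → List ℕ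
  shift k = map (_+ k)

  countAbove-shift : ∀ k x ys → countAbove (x + k) (shift k ys) ≡ countAbove x ys
  countAbove-shift k x [] = refl
  countAbove-shift k x (y ∷ ys) rewrite +-<ᵇ-cancelʳ k x y = cong (𝟙 (x <ᵇ y) +_) (countAbove-shift k x ys)

  countBelow-shift : ∀ k x ys → countBelow (x + k) (shift k ys) ≡ countBelow x ys
  countBelow-shift k x [] = refl
  countBelow-shift k x (y ∷ ys) rewrite +-<ᵇ-cancelʳ k y x = cong (𝟙 (y <ᵇ x) +_) (countBelow-shift k x ys)

  count123From-shift : ∀ k x ys → count123From (x + k) (shift k ys) ≡ count123From x ys
  count123From-shift k x [] = refl
  count123From-shift k x (y ∷ ys) rewrite +-<ᵇ-cancelʳ k x y | countAbove-shift k y ys | count123From-shift k x ys = refl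

  count231From-shift : ∀ k x ys → count231From (x + k) (shift k ys) ≡ count231From x ys
  count231From-shift k x [] = refl
  count231From-shift k x (y ∷ ys) rewrite +-<ᵇ-cancelʳ k x y | countBelow-shift k x ys | count231From-shift k x ys = refl

  count12-shift : ∀ k xs → count12 (shift k xs) ≡ count12 xs
  count12-shift k [] = refl
  count12-shift k (x ∷ xs) rewrite countAbove-shift k x xs | count12-shift k xs = refl

  count123-shift : ∀ k xs → count123 (shift k xs) ≡ count123 xs
  count123-shift k [] = refl
  count123-shift k (x ∷ xs) rewrite count123From-shift k x xs | count123-shift k xs = refl

  count231-shift : ∀ k xs → count231 (shift k xs) ≡ count231 xs
  count231-shift k [] = refl
  count231-shift k (x ∷ xs) rewrite count231From-shift k x xs | count231-shift k xs = refl

module OneLineNotation where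

  open ListSums
  open PatternCounts
  open import Data.Nat using (ℕ; zero; suc; _+_; _<ᵇ_; _≡ᵇ_)
  open import Data.Bool using (Bool; true; false; _∧_; _∨_; not; if_then_else_)
  open import Data.Bool.Properties using (∧-identityʳ; ∧-zeroʳ; ∧-assoc)
  open import Data.Fin using (Fin; zero; suc; toℕ)
  open import Data.List using (List; []; _∷_; _++_; map; concatMap; allFin; all; and)
  open import Data.List.Properties using (map-tabulate)
  open import Data.Nat.ListAction using (sum)
  open import Data.Vec using (Vec; lookup) renaming ([] to []ᵥ; _∷_ to _∷ᵥ_)
  open import Data.Product using (_×_; _,_; proj₁; proj₂; Σ)
  open import Relation.Binary.PropositionalEquality
  open import Function using (_∘_; id)

  values : ∀ {m k} → Vec (Fin m) k → List ℕ
  values []ᵥ = []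
  values (x ∷ᵥ xs) = toℕ x ∷ values xs

  ∑Fin : ∀ {k} → (Fin k → ℕ) → ℕ
  ∑Fin {k} f = sumMap f (allFin k)

  ∑Fin-suc : ∀ {k} (f : Fin (suc k) → ℕ) → ∑Fin f ≡ f zero + ∑Fin (f ∘ suc)
  ∑Fin-suc {k} f = cong (f zero +_) (trans (cong sum (map-tabulate suc f)) (sym (cong sum (map-tabulate id (f ∘ suc)))))

  ∑Fin-cong : ∀ {k} {f g : Fin k → ℕ} → (∀ i → f i ≡ g i) → ∑Fin f ≡ ∑Fin g
  ∑Fin-cong {k} e = sumMap-cong e (allFin k)

  ∑Fin-zero : ∀ k → ∑Fin {k} (λ _ → 0) ≡ 0
  ∑Fin-zero k = sumMap-zero (allFin k)

  count≡∑Fin³ : ∀ {k} (p : Fin k × Fin k × Fin k → Bool) →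
    count p (triples k) ≡ ∑Fin (λ i → ∑Fin (λ j → ∑Fin (λ l → 𝟙 (p (i , j , l)))))
  count≡∑Fin³ {k} p = trans (sumMap-concatMap (𝟙 ∘ p) _ (allFin k))
    (sumMap-cong (λ i → trans (sumMap-concatMap (𝟙 ∘ p) _ (allFin k))
      (sumMap-cong (λ j → sumMap-map (𝟙 ∘ p) _ (allFin k)) (allFin k))) (allFin k))

  m≡0⇒m+n≡n : ∀ {a b} → a ≡ 0 → a + b ≡ b
  m≡0⇒m+n≡n refl = refl

  pairsWith : (ℕ → ℕ → Bool) → List ℕ → ℕ
  pairsWith q [] = 0
  pairsWith q (y ∷ ys) = countWith (q y) ys + pairsWith q ys

  triplesWith : (ℕ → ℕ → ℕ → Bool) → List ℕ → ℕ
  triplesWith P [] = 0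
  triplesWith P (x ∷ xs) = pairsWith (P x) xs + triplesWith P xs

  occurrence : ∀ {m k} → (ℕ → ℕ → ℕ → Bool) → Vec (Fin m) k → Fin k × Fin k × Fin k → Bool
  occurrence P σ (i , j , l) = (i <ꟳ j) ∧ (j <ꟳ l) ∧ P (toℕ (lookup σ i)) (toℕ (lookup σ j)) (toℕ (lookup σ l))

  ∑Fin-countWith : ∀ {m k} (r : ℕ → Bool) (xs : Vec (Fin m) k) →
    ∑Fin (λ l → 𝟙 (r (toℕ (lookup xs l)))) ≡ countWith r (values xs)
  ∑Fin-countWith r []ᵥ = refl
  ∑Fin-countWith r (x ∷ᵥ xs) =
    trans (∑Fin-suc (λ l → 𝟙 (r (toℕ (lookup (x ∷ᵥ xs) l))))) (cong (𝟙 (r (toℕ x)) +_) (∑Fin-countWith r xs))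

  ∑Fin²-pairsWith : ∀ {m k} (q : ℕ → ℕ → Bool) (xs : Vec (Fin m) k) →
    ∑Fin (λ j → ∑Fin (λ l → 𝟙 ((j <ꟳ l) ∧ q (toℕ (lookup xs j)) (toℕ (lookup xs l))))) ≡ pairsWith q (values xs)
  ∑Fin²-pairsWith q []ᵥ = refl
  ∑Fin²-pairsWith q (y ∷ᵥ ys) =
    trans (∑Fin-suc (λ j → ∑Fin (λ l → 𝟙 ((j <ꟳ l) ∧ q (toℕ (lookup σ j)) (toℕ (lookup σ l))))))
      (cong₂ _+_ (trans (∑Fin-suc (λ l → 𝟙 ((zero <ꟳ l) ∧ q (toℕ y) (toℕ (lookup σ l))))) (∑Fin-countWith (q (toℕ y)) ys))
                 (trans (∑Fin-cong (λ j → ∑Fin-suc (λ l → 𝟙 ((suc j <ꟳ l) ∧ q (toℕ (lookup ys j)) (toℕ (lookup σ l))))))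
                        (∑Fin²-pairsWith q ys)))
    where σ = y ∷ᵥ ys

  ∑Fin³-triplesWith : ∀ {m k} (P : ℕ → ℕ → ℕ → Bool) (σ : Vec (Fin m) k) →
    ∑Fin (λ i → ∑Fin (λ j → ∑Fin (λ l → 𝟙 (occurrence P σ (i , j , l))))) ≡ triplesWith P (values σ)
  ∑Fin³-triplesWith P []ᵥ = refl
  ∑Fin³-triplesWith {k = suc k} P (x ∷ᵥ xs) =
    trans (∑Fin-suc (λ i → ∑Fin (λ j → ∑Fin (λ l → 𝟙 (occurrence P σ (i , j , l))))))
      (cong₂ _+_ first-slice (trans (∑Fin-cong later-slice) (∑Fin³-triplesWith P xs)))
    where
    σ = x ∷ᵥ xs
    first-slice : ∑Fin (λ j → ∑Fin (λ l → 𝟙 (occurrence P σ (zero , j , l)))) ≡ pairsWith (P (toℕ x)) (values xs)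
    first-slice =
      trans (∑Fin-suc (λ j → ∑Fin (λ l → 𝟙 (occurrence P σ (zero , j , l)))))
        (trans (m≡0⇒m+n≡n (∑Fin-zero (suc k)))
          (trans (∑Fin-cong (λ j → ∑Fin-suc (λ l → 𝟙 (occurrence P σ (zero , suc j , l)))))
            (∑Fin²-pairsWith (P (toℕ x)) xs)))
    -- The terms with j = zero or l = zero vanish, since then i < j or j < l fails.
    later-slice : ∀ i → ∑Fin (λ j → ∑Fin (λ l → 𝟙 (occurrence P σ (suc i , j , l))))
                      ≡ ∑Fin (λ j → ∑Fin (λ l → 𝟙 (occurrence P xs (i , j , l))))
    later-slice i =
      trans (∑Fin-suc (λ j → ∑Fin (λ l → 𝟙 (occurrence P σ (suc i , j , l)))))
        (trans (m≡0⇒m+n≡n (∑Fin-zero (suc k)))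
          (∑Fin-cong (λ j → trans (∑Fin-suc (λ l → 𝟙 (occurrence P σ (suc i , suc j , l))))
                                  (m≡0⇒m+n≡n (cong 𝟙 (∧-zeroʳ (i <ꟳ j)))))))

  count-occurrence : ∀ {m k} (P : ℕ → ℕ → ℕ → Bool) (σ : Vec (Fin m) k) →
    count (occurrence P σ) (triples k) ≡ triplesWith P (values σ)
  count-occurrence P σ = trans (count≡∑Fin³ (occurrence P σ)) (∑Fin³-triplesWith P σ)

  countWith-cong : ∀ {r r′ : ℕ → Bool} → (∀ w → r w ≡ r′ w) → ∀ ys → countWith r ys ≡ countWith r′ ys
  countWith-cong e [] = refl
  countWith-cong e (y ∷ ys) = cong₂ _+_ (cong 𝟙 (e y)) (countWith-cong e ys)

  countWith-false : ∀ ys → countWith (λ _ → false) ys ≡ 0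
  countWith-false [] = refl
  countWith-false (y ∷ ys) = countWith-false ys

  countWith-∧ˡ : ∀ b (r : ℕ → Bool) ys → countWith (λ w → b ∧ r w) ys ≡ (if b then countWith r ys else 0)
  countWith-∧ˡ true r ys = refl
  countWith-∧ˡ false r ys = countWith-false ys

  countWith-∧ʳ : ∀ b (r : ℕ → Bool) ys → countWith (λ w → r w ∧ b) ys ≡ (if b then countWith r ys else 0)
  countWith-∧ʳ true r ys = countWith-cong (λ w → ∧-identityʳ (r w)) ys
  countWith-∧ʳ false r ys = trans (countWith-cong (λ w → ∧-zeroʳ (r w)) ys) (countWith-false ys)

  triplesWith-123 : ∀ xs → triplesWith (λ a b c → (a <ᵇ b) ∧ (b <ᵇ c)) xs ≡ count123 xs
  triplesWith-123 [] = refl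
  triplesWith-123 (x ∷ xs) = cong₂ _+_ (pairsWith-123 xs) (triplesWith-123 xs)
    where
    pairsWith-123 : ∀ ys → pairsWith (λ b c → (x <ᵇ b) ∧ (b <ᵇ c)) ys ≡ count123From x ys
    pairsWith-123 [] = refl
    pairsWith-123 (y ∷ ys) = cong₂ _+_ (countWith-∧ˡ (x <ᵇ y) (y <ᵇ_) ys) (pairsWith-123 ys)

  triplesWith-231 : ∀ xs → triplesWith (λ a b c → (c <ᵇ a) ∧ (a <ᵇ b)) xs ≡ count231 xs
  triplesWith-231 [] = refl
  triplesWith-231 (x ∷ xs) = cong₂ _+_ (pairsWith-231 xs) (triplesWith-231 xs)
    where
    pairsWith-231 : ∀ ys → pairsWith (λ b c → (c <ᵇ x) ∧ (x <ᵇ b)) ys ≡ count231From x ys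
    pairsWith-231 [] = refl
    pairsWith-231 (y ∷ ys) = cong₂ _+_ (countWith-∧ʳ (x <ᵇ y) (_<ᵇ x) ys) (pairsWith-231 ys)

  num123≡count123 : ∀ {n} (σ : Vec (Fin n) n) → num123 σ ≡ count123 (values σ)
  num123≡count123 σ = trans (count-occurrence (λ a b c → (a <ᵇ b) ∧ (b <ᵇ c)) σ) (triplesWith-123 (values σ))

  -- avoids231 and isPerm use equality tests local to their definitions; unification names them.
  mutual
    avoids231-≡ᵇ0 : ∀ {n} (σ : Vec (Fin n) n) (k : ℕ) → _ ≡ (k ≡ᵇ 0)
    avoids231-≡ᵇ0 σ zero = refl
    avoids231-≡ᵇ0 σ (suc k) = refl

    avoids231≡count≡ᵇ0 : ∀ {n} (σ : Vec (Fin n) n) → avoids231 σ ≡ (count (occ231 σ) (triples n) ≡ᵇ 0)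
    avoids231≡count≡ᵇ0 {n} σ with count (occ231 σ) (triples n)
    ... | k = avoids231-≡ᵇ0 σ k

  avoids231≡count231≡ᵇ0 : ∀ {n} (σ : Vec (Fin n) n) → avoids231 σ ≡ (count231 (values σ) ≡ᵇ 0)
  avoids231≡count231≡ᵇ0 σ = trans (avoids231≡count≡ᵇ0 σ)
    (cong (_≡ᵇ 0) (trans (count-occurrence (λ a b c → (c <ᵇ a) ∧ (a <ᵇ b)) σ) (triplesWith-231 (values σ))))

  distinctAt : ∀ {m k} → Vec (Fin m) k → Fin k × Fin k → Bool
  distinctAt σ (i , j) = not (i <ꟳ j) ∨ not (toℕ (lookup σ i) ≡ᵇ toℕ (lookup σ j))

  isPerm-predicate : ∀ {n} (σ : Vec (Fin n) n) → Σ (Fin n × Fin n → Bool) λ P → isPerm σ ≡ all P (pairs n)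
  isPerm-predicate σ = _ , refl

  mutual
    isPerm-≡ᵇ : ∀ {n} (σ : Vec (Fin n) n) (a b : ℕ) → _ ≡ (a ≡ᵇ b)
    isPerm-≡ᵇ σ zero zero = refl
    isPerm-≡ᵇ σ zero (suc b) = refl
    isPerm-≡ᵇ σ (suc a) zero = refl
    isPerm-≡ᵇ σ (suc a) (suc b) = isPerm-≡ᵇ σ a b

    isPerm-predicate≡distinctAt : ∀ {n} (σ : Vec (Fin n) n) i j →
      proj₁ (isPerm-predicate σ) (i , j) ≡ distinctAt σ (i , j)
    isPerm-predicate≡distinctAt σ i j with i <ꟳ j
    ... | false = refl
    ... | true with toℕ (lookup σ i) | toℕ (lookup σ j)
    ... | a | b = cong not (isPerm-≡ᵇ σ a b)

  all-cong : {A : Set} {f g : A → Bool} → (∀ x → f x ≡ g x) → (xs : List A) → all f xs ≡ all g xs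
  all-cong e [] = refl
  all-cong e (x ∷ xs) = cong₂ _∧_ (e x) (all-cong e xs)

  all-++ : {A : Set} (f : A → Bool) (xs ys : List A) → all f (xs ++ ys) ≡ all f xs ∧ all f ys
  all-++ f [] ys = refl
  all-++ f (x ∷ xs) ys = trans (cong (f x ∧_) (all-++ f xs ys)) (sym (∧-assoc (f x) (all f xs) (all f ys)))

  all-concatMap : {A B : Set} (f : B → Bool) (g : A → List B) (xs : List A) →
    all f (concatMap g xs) ≡ all (λ x → all f (g x)) xs
  all-concatMap f g [] = refl
  all-concatMap f g (x ∷ xs) = trans (all-++ f (g x) (concatMap g xs)) (cong (all f (g x) ∧_) (all-concatMap f g xs))

  all-map : {A B : Set} (f : B → Bool) (h : A → B) (xs : List A) → all f (map h xs) ≡ all (f ∘ h) xs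
  all-map f h [] = refl
  all-map f h (x ∷ xs) = cong (f (h x) ∧_) (all-map f h xs)

  allFin-suc : ∀ {k} (f : Fin (suc k) → Bool) → all f (allFin (suc k)) ≡ f zero ∧ all (f ∘ suc) (allFin k)
  allFin-suc {k} f = cong (f zero ∧_) (trans (cong and (map-tabulate suc f)) (sym (cong and (map-tabulate id (f ∘ suc)))))

  allDistinct : List ℕ → Bool
  allDistinct [] = true
  allDistinct (x ∷ xs) = all (λ y → not (x ≡ᵇ y)) xs ∧ allDistinct xs

  allFin²-distinctAt : ∀ {m k} (σ : Vec (Fin m) k) →
    all (λ i → all (λ j → distinctAt σ (i , j)) (allFin k)) (allFin k) ≡ allDistinct (values σ)
  allFin²-distinctAt []ᵥ = refl
  allFin²-distinctAt {k = suc k} (x ∷ᵥ xs) =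
    trans (allFin-suc (λ i → all (λ j → distinctAt σ (i , j)) (allFin (suc k))))
      (cong₂ _∧_ (trans (allFin-suc (λ j → distinctAt σ (zero , j))) (distinct-head xs))
                 (trans (all-cong (λ i → allFin-suc (λ j → distinctAt σ (suc i , j))) (allFin k)) (allFin²-distinctAt xs)))
    where
    σ = x ∷ᵥ xs
    distinct-head : ∀ {k} (ys : Vec (Fin _) k) →
      all (λ j → not (toℕ x ≡ᵇ toℕ (lookup ys j))) (allFin k) ≡ all (λ y → not (toℕ x ≡ᵇ y)) (values ys)
    distinct-head []ᵥ = refl
    distinct-head (y ∷ᵥ ys) = trans (allFin-suc (λ j → not (toℕ x ≡ᵇ toℕ (lookup (y ∷ᵥ ys) j))))
      (cong (not (toℕ x ≡ᵇ toℕ y) ∧_) (distinct-head ys))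

  isPerm≡allDistinct : ∀ {n} (σ : Vec (Fin n) n) → isPerm σ ≡ allDistinct (values σ)
  isPerm≡allDistinct {n} σ = begin
    isPerm σ                                                               ≡⟨ proj₂ (isPerm-predicate σ) ⟩
    all (proj₁ (isPerm-predicate σ)) (pairs n)                             ≡⟨ all-cong (λ (i , j) → isPerm-predicate≡distinctAt σ i j) (pairs n) ⟩
    all (distinctAt σ) (pairs n)                                           ≡⟨ all-concatMap (distinctAt σ) _ (allFin n) ⟩
    all (λ i → all (distinctAt σ) (map (i ,_) (allFin n))) (allFin n)      ≡⟨ all-cong (λ i → all-map (distinctAt σ) (i ,_) (allFin n)) (allFin n) ⟩
    all (λ i → all (λ j → distinctAt σ (i , j)) (allFin n)) (allFin n)     ≡⟨ allFin²-distinctAt σ ⟩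
    allDistinct (values σ)                                                 ∎
    where open ≡-Reasoning

module UniqueLists where

  open ListSums
  open import Data.Nat using (ℕ; _+_)
  open import Data.Nat.Properties using ()
  open import Data.List using (List; []; _∷_; _++_; concatMap)
  open import Data.List.Relation.Unary.All as All using (All)
  open All.All
  open import Data.List.Relation.Unary.Any using (here; there)
  open import Data.List.Relation.Unary.AllPairs using ([]; _∷_)
  open import Data.List.Relation.Unary.Unique.Propositional using (Unique)
  import Data.List.Relation.Unary.Unique.Propositional.Properties as Unique
  open import Data.List.Membership.Propositional using (_∈_; _∉_; find)
  open import Data.List.Membership.Propositional.Properties using (∈-∃++; ∈-++⁻; ∈-++⁺ˡ; ∈-++⁺ʳ; ∈-concatMap⁻)
  open import Data.Product using (_×_; _,_)
  open import Data.Sum using (inj₁; inj₂)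
  open import Data.Empty using (⊥; ⊥-elim)
  open import Relation.Binary.PropositionalEquality
  open import Function using (_∘_)
  import Data.List.Relation.Unary.All.Properties as All

  All-delete : {A : Set} {P : A → Set} (as : List A) {x : A} {bs : List A} → All P (as ++ x ∷ bs) → All P (as ++ bs)
  All-delete [] (p ∷ ps) = ps
  All-delete (a ∷ as) (p ∷ ps) = p ∷ All-delete as ps

  All-middle : {A : Set} {P : A → Set} (as : List A) {x : A} {bs : List A} → All P (as ++ x ∷ bs) → P x
  All-middle [] (p ∷ ps) = p
  All-middle (a ∷ as) (p ∷ ps) = All-middle as ps

  Unique-delete : {A : Set} (as : List A) {x : A} {bs : List A} →
    Unique (as ++ x ∷ bs) → Unique (as ++ bs) × x ∉ as ++ bs
  Unique-delete [] (p ∷ ps) = ps , λ m → All.lookup p m refl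
  Unique-delete (a ∷ as) (p ∷ ps) with Unique-delete as ps
  ... | u , x∉ = (All-delete as p ∷ u) , λ { (here refl) → All-middle as p refl ; (there m) → x∉ m }

  Unique-++⁻ : {A : Set} (xs : List A) {ys : List A} → Unique (xs ++ ys) → Unique xs × Unique ys
  Unique-++⁻ [] u = [] , u
  Unique-++⁻ (x ∷ xs) (x∉ ∷ u) with Unique-++⁻ xs u
  ... | u₁ , u₂ = All.++⁻ˡ xs x∉ ∷ u₁ , u₂

  Unique-concatMap : {A B : Set} (f : A → List B) (xs : List A) → Unique xs →
    (∀ {x} → x ∈ xs → Unique (f x)) →
    (∀ {x y b} → x ∈ xs → y ∈ xs → b ∈ f x → b ∈ f y → x ≡ y) → Unique (concatMap f xs)
  Unique-concatMap f [] _ _ _ = []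
  Unique-concatMap f (x ∷ xs) (x∉xs ∷ u) uf disjoint =
    Unique.++⁺ (uf (here refl)) (Unique-concatMap f xs u (uf ∘ there) (λ a b → disjoint (there a) (there b)))
      (λ (b∈fx , b∈rest) → not-later b∈fx b∈rest)
    where
    not-later : ∀ {b} → b ∈ f x → b ∈ concatMap f xs → ⊥
    not-later b∈fx b∈rest with find (∈-concatMap⁻ f {xs = xs} b∈rest)
    ... | y , y∈xs , b∈fy = All.lookup x∉xs y∈xs (disjoint (here refl) (there y∈xs) b∈fx b∈fy)

  sumMap-Unique-sameElements : {A : Set} (f : A → ℕ) (xs ys : List A) → Unique xs → Unique ys →
    (∀ {z} → z ∈ xs → z ∈ ys) → (∀ {z} → z ∈ ys → z ∈ xs) → sumMap f xs ≡ sumMap f ys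
  sumMap-Unique-sameElements f [] [] _ _ _ _ = refl
  sumMap-Unique-sameElements f [] (y ∷ ys) _ _ _ ys⊆ with ys⊆ (here refl)
  ... | ()
  sumMap-Unique-sameElements f (x ∷ xs) ys (x∉xs ∷ uxs) uys xs⊆ ys⊆ with ∈-∃++ (xs⊆ (here refl))
  ... | as , bs , refl with Unique-delete as uys
  ... | u , x∉ = trans (cong (f x +_) (sumMap-Unique-sameElements f xs (as ++ bs) uxs u xs⊆′ ys⊆′)) (sym move-x)
    where
    xs⊆′ : ∀ {z} → z ∈ xs → z ∈ as ++ bs
    xs⊆′ m with ∈-++⁻ as (xs⊆ (there m))
    ... | inj₁ m₁ = ∈-++⁺ˡ m₁
    ... | inj₂ (here refl) = ⊥-elim (All.lookup x∉xs m refl)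
    ... | inj₂ (there m₂) = ∈-++⁺ʳ as m₂
    ys⊆′ : ∀ {z} → z ∈ as ++ bs → z ∈ xs
    ys⊆′ m with ys⊆ (insert m)
      where
      insert : ∀ {z} → z ∈ as ++ bs → z ∈ as ++ x ∷ bs
      insert m with ∈-++⁻ as m
      ... | inj₁ m₁ = ∈-++⁺ˡ m₁
      ... | inj₂ m₂ = ∈-++⁺ʳ as (there m₂)
    ... | here refl = ⊥-elim (x∉ m)
    ... | there m₃ = m₃
    move-x : sumMap f (as ++ x ∷ bs) ≡ f x + sumMap f (as ++ bs)
    move-x = begin
      sumMap f (as ++ x ∷ bs)                ≡⟨ sumMap-++ f as (x ∷ bs) ⟩
      sumMap f as + (f x + sumMap f bs)      ≡⟨ x∙yz≈y∙xz (sumMap f as) (f x) (sumMap f bs) ⟩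
      f x + (sumMap f as + sumMap f bs)      ≡⟨ cong (f x +_) (sumMap-++ f as bs) ⟨
      f x + sumMap f (as ++ bs)              ∎
      where
      open ≡-Reasoning
      open import Data.Nat.Properties using (+-commutativeSemigroup)
      open import Algebra.Properties.CommutativeSemigroup +-commutativeSemigroup using (x∙yz≈y∙xz)

module Avoiders where

  open ListSums
  open PatternCounts
  open OneLineNotation
  open UniqueLists
  open import Data.Nat using (ℕ; zero; suc; _<_; _≡ᵇ_)
  open import Data.Nat.Properties using (≡ᵇ⇒≡; ≡⇒≡ᵇ)
  open import Data.Bool using (Bool; true; false; _∧_; not; T)
  open import Data.Bool.Properties using (T?; T-∧; T-not-≡)
  open import Data.Fin using (Fin; fromℕ<)
  open import Data.Fin.Properties using (toℕ<n; toℕ-injective; toℕ-fromℕ<)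
  open import Data.List using (List; []; _∷_; map; allFin; all; length)
  open import Data.List.Relation.Unary.All as All using (All)
  open All.All
  open import Data.List.Relation.Unary.All.Properties using (all⁺; all⁻)
  import Data.List.Relation.Unary.Any as Any
  open import Data.List.Relation.Unary.Any using (here)
  open import Data.List.Relation.Unary.AllPairs using ([]; _∷_)
  open import Data.List.Relation.Unary.Unique.Propositional using (Unique)
  import Data.List.Relation.Unary.Unique.Propositional.Properties as Unique
  open import Data.List.Membership.Propositional using (_∈_)
  open import Data.List.Membership.Propositional.Properties using (∈-map⁺; ∈-map⁻; ∈-concatMap⁺; ∈-allFin; ∈-filter⁺; ∈-filter⁻)
  open import Data.Vec using (Vec) renaming ([] to []ᵥ; _∷_ to _∷ᵥ_)
  open import Data.Product using (_×_; _,_; proj₁; proj₂)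
  open import Function using (_∘_; Equivalence)
  open import Relation.Binary.PropositionalEquality

  allDistinct⇒Unique : ∀ xs → T (allDistinct xs) → Unique xs
  allDistinct⇒Unique [] _ = []
  allDistinct⇒Unique (x ∷ xs) t with Equivalence.to (T-∧ {all (λ y → not (x ≡ᵇ y)) xs}) t
  ... | t₁ , t₂ =
    All.map (λ {y} x≠y x≡y → subst T (Equivalence.to T-not-≡ x≠y) (≡⇒≡ᵇ x y x≡y)) (all⁺ _ xs t₁) ∷ allDistinct⇒Unique xs t₂

  Unique⇒allDistinct : ∀ xs → Unique xs → T (allDistinct xs)
  Unique⇒allDistinct [] _ = _
  Unique⇒allDistinct (x ∷ xs) (x∉ ∷ u) =
    Equivalence.from T-∧ (all⁻ _ (All.map (λ {y} x≢y → Equivalence.from T-not-≡ (≢⇒≡ᵇ≡false x y x≢y)) x∉)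
                         , Unique⇒allDistinct xs u)
    where
    ≢⇒≡ᵇ≡false : ∀ x y → x ≢ y → (x ≡ᵇ y) ≡ false
    ≢⇒≡ᵇ≡false x y x≢y with x ≡ᵇ y in e
    ... | false = refl
    ... | true = contradiction (≡ᵇ⇒≡ x y (subst T (sym e) _)) x≢y
      where open import Relation.Nullary using (contradiction)

  words-complete : ∀ {n k} (v : Vec (Fin n) k) → v ∈ words n k
  words-complete []ᵥ = here refl
  words-complete {n} {suc k} (a ∷ᵥ w) = ∈-concatMap⁺ (λ b → map (b ∷ᵥ_) (words n k)) {xs = allFin n}
    (Any.map (λ { refl → ∈-map⁺ (a ∷ᵥ_) (words-complete w) }) (∈-allFin a))

  ∷ᵥ-injective : ∀ {n k} {a b : Fin n} {u v : Vec (Fin n) k} → a ∷ᵥ u ≡ b ∷ᵥ v → a ≡ b × u ≡ v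
  ∷ᵥ-injective refl = refl , refl

  words-unique : ∀ n k → Unique (words n k)
  words-unique n zero = [] ∷ []
  words-unique n (suc k) = Unique-concatMap (λ b → map (b ∷ᵥ_) (words n k)) (allFin n) (Unique.allFin⁺ n)
    (λ _ → Unique.map⁺ (proj₂ ∘ ∷ᵥ-injective) (words-unique n k)) same-head
    where
    same-head : ∀ {x y w} → x ∈ allFin n → y ∈ allFin n →
      w ∈ map (x ∷ᵥ_) (words n k) → w ∈ map (y ∷ᵥ_) (words n k) → x ≡ y
    same-head _ _ wx wy with ∈-map⁻ _ wx | ∈-map⁻ _ wy
    ... | _ , _ , refl | _ , _ , e = proj₁ (∷ᵥ-injective e)

  values-length : ∀ {m k} (σ : Vec (Fin m) k) → length (values σ) ≡ k
  values-length []ᵥ = refl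
  values-length (x ∷ᵥ xs) = cong suc (values-length xs)

  values-bounded : ∀ {m k} (σ : Vec (Fin m) k) → All (_< m) (values σ)
  values-bounded []ᵥ = []
  values-bounded (x ∷ᵥ xs) = toℕ<n x ∷ values-bounded xs

  values-injective : ∀ {m k} (u v : Vec (Fin m) k) → values u ≡ values v → u ≡ v
  values-injective []ᵥ []ᵥ _ = refl
  values-injective (x ∷ᵥ xs) (y ∷ᵥ ys) e =
    cong₂ _∷ᵥ_ (toℕ-injective (∷-injectiveˡ e)) (values-injective xs ys (∷-injectiveʳ e))
    where open import Data.List.Properties using (∷-injectiveˡ; ∷-injectiveʳ)

  fromValues : ∀ {m} (l : List ℕ) → All (_< m) l → Vec (Fin m) (length l)
  fromValues [] [] = []ᵥ
  fromValues (x ∷ xs) (p ∷ ps) = fromℕ< p ∷ᵥ fromValues xs ps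

  values-fromValues : ∀ {m} (l : List ℕ) (ps : All (_< m) l) → values (fromValues l ps) ≡ l
  values-fromValues [] [] = refl
  values-fromValues (x ∷ xs) (p ∷ ps) = cong₂ _∷_ (toℕ-fromℕ< p) (values-fromValues xs ps)

  Is231Avoider : ℕ → List ℕ → Set
  Is231Avoider n l = length l ≡ n × All (_< n) l × Unique l × count231 l ≡ 0

  avoiders : ℕ → List (List ℕ)
  avoiders n = map values (S231 n)

  inS231 : ∀ {n} → Vec (Fin n) n → Bool
  inS231 σ = isPerm σ ∧ avoids231 σ

  avoiders-unique : ∀ n → Unique (avoiders n)
  avoiders-unique n = Unique.map⁺ (values-injective _ _)
    (Unique.filter⁺ (T? ∘ inS231) (words-unique n n))

  ∈avoiders⇒Is231Avoider : ∀ {n l} → l ∈ avoiders n → Is231Avoider n l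
  ∈avoiders⇒Is231Avoider {n} l∈ with ∈-map⁻ values l∈
  ... | σ , σ∈ , refl with Equivalence.to T-∧ (proj₂ (∈-filter⁻ (T? ∘ inS231) {xs = words n n} σ∈))
  ... | perm , avoids = values-length σ , values-bounded σ
    , allDistinct⇒Unique (values σ) (subst T (isPerm≡allDistinct σ) perm)
    , ≡ᵇ⇒≡ (count231 (values σ)) 0 (subst T (avoids231≡count231≡ᵇ0 σ) avoids)

  Is231Avoider⇒∈avoiders : ∀ {n l} → Is231Avoider n l → l ∈ avoiders n
  Is231Avoider⇒∈avoiders {l = l} (refl , bounded , unique , no231) =
    subst (_∈ avoiders (length l)) (values-fromValues l bounded)
      (∈-map⁺ values (∈-filter⁺ (T? ∘ inS231) (words-complete σ) (Equivalence.from T-∧ (perm , avoids))))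
    where
    σ = fromValues l bounded
    perm : T (isPerm σ)
    perm = subst T (sym (isPerm≡allDistinct σ))
      (subst (T ∘ allDistinct) (sym (values-fromValues l bounded)) (Unique⇒allDistinct l unique))
    avoids : T (avoids231 σ)
    avoids = subst T (sym (avoids231≡count231≡ᵇ0 σ)) (≡⇒≡ᵇ _ 0 (trans (cong count231 (values-fromValues l bounded)) no231))

  total123≡sumMap-count123 : ∀ n → total123 n ≡ sumMap count123 (avoiders n)
  total123≡sumMap-count123 n =
    trans (sumMap-cong num123≡count123 (S231 n)) (sym (sumMap-map count123 values (S231 n)))

module Decomposition where

  open PatternCounts
  open UniqueLists
  open Avoiders
  open import Data.Nat using (ℕ; zero; suc; _+_; _*_; _∸_; _<_; _≤_; _<?_; _≟_; z≤n; s≤s)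
  open import Data.Nat.Properties
  open import Data.Bool using (if_then_else_)
  open import Data.List using (List; []; _∷_; _++_; map; concatMap; length; upTo)
  open import Data.List.Properties using (length-map; length-++; map-injective; ∷-injective; ∷-injectiveʳ)
  open import Data.List.Relation.Unary.All as All using (All)
  open All.All
  import Data.List.Relation.Unary.All.Properties as All
  import Data.List.Relation.Unary.Any as Any
  open import Data.List.Relation.Unary.Any using (here; there)
  open import Data.List.Relation.Unary.AllPairs using ([]; _∷_)
  open import Data.List.Relation.Unary.Unique.Propositional using (Unique)
  import Data.List.Relation.Unary.Unique.Propositional.Properties as Unique
  open import Data.List.Membership.Propositional using (_∈_; _∉_; find)
  open import Data.List.Membership.Propositional.Properties
    using (∈-map⁺; ∈-map⁻; ∈-concatMap⁺; ∈-concatMap⁻; ∈-upTo⁺; ∈-upTo⁻; ∈-∃++)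
  open import Data.List.Membership.DecPropositional _≟_ using (_∈?_)
  open import Data.Product using (_×_; _,_; proj₁; proj₂; Σ-syntax)
  open import Relation.Nullary using (yes; no)
  open import Relation.Binary.PropositionalEquality

  assemble : ℕ → List ℕ → List ℕ → List ℕ
  assemble m α β = m ∷ α ++ shift (suc m) β

  assembliesWithHead : ℕ → ℕ → List (List ℕ)
  assembliesWithHead n m = concatMap (λ α → map (assemble m α) (avoiders (n ∸ m))) (avoiders m)

  assemblies : ℕ → List (List ℕ)
  assemblies n = concatMap (assembliesWithHead n) (upTo (suc n))

  shift-above : ∀ m β → All (m <_) (shift (suc m) β)
  shift-above m [] = []
  shift-above m (b ∷ β) = subst (m <_) (sym (+-suc b m)) (s≤s (m≤n+m m b)) ∷ shift-above m β

  shift-bounded : ∀ m k β → All (_< k) β → All (_< k + suc m) (shift (suc m) β)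
  shift-bounded m k [] [] = []
  shift-bounded m k (b ∷ β) (p ∷ ps) = +-monoˡ-< (suc m) p ∷ shift-bounded m k β ps

  assemble-Is231Avoider : ∀ {n m α β} → m ≤ n → Is231Avoider m α → Is231Avoider (n ∸ m) β →
    Is231Avoider (suc n) (assemble m α β)
  assemble-Is231Avoider {n} {m} {α} {β} m≤n (|α| , α<m , α-unique , α-no231) (|β| , β<n∸m , β-unique , β-no231) =
    length≡ , bounded , unique , no231
    where
    β′ = shift (suc m) β
    m<β′ = shift-above m β
    length≡ : length (assemble m α β) ≡ suc n
    length≡ = cong suc (trans (length-++ α)
      (trans (cong₂ _+_ |α| (trans (length-map (_+ suc m) β) |β|)) (m+[n∸m]≡n m≤n)))
    bounded : All (_< suc n) (assemble m α β)
    bounded = s≤s m≤n ∷ All.++⁺ (All.map (λ p → <-trans p (s≤s m≤n)) α<m)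
      (All.map (λ {x} → subst (x <_) (trans (+-suc (n ∸ m) m) (cong suc (m∸n+n≡m m≤n))))
               (shift-bounded m (n ∸ m) β β<n∸m))
    unique : Unique (assemble m α β)
    unique = All.++⁺ (All.map (λ p → ≢-sym (<⇒≢ p)) α<m) (All.map <⇒≢ m<β′)
           ∷ Unique.++⁺ α-unique (Unique.map⁺ (+-cancelʳ-≡ (suc m) _ _) β-unique)
               (λ (x∈α , x∈β′) → <-irrefl refl (<-trans (All.lookup α<m x∈α) (All.lookup m<β′ x∈β′)))
    no231 : count231 (assemble m α β) ≡ 0
    no231 = cong₂ _+_ (trans (count231From-low-++ α β′ α<m) (count231From-all β′ m<β′))
      (trans (Separated.count231-separated m α β′ α<m m<β′)
             (cong₂ _+_ α-no231 (trans (count231-shift (suc m) β) β-no231)))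

  ∈assemblies⇒Is231Avoider : ∀ {n l} → l ∈ assemblies n → Is231Avoider (suc n) l
  ∈assemblies⇒Is231Avoider {n} l∈ with find (∈-concatMap⁻ (assembliesWithHead n) {xs = upTo (suc n)} l∈)
  ... | m , m∈ , l∈′ with find (∈-concatMap⁻ (λ α → map (assemble m α) (avoiders (n ∸ m))) {xs = avoiders m} l∈′)
  ... | α , α∈ , l∈map with ∈-map⁻ (assemble m α) l∈map
  ... | β , β∈ , refl =
    assemble-Is231Avoider (≤-pred (∈-upTo⁻ m∈)) (∈avoiders⇒Is231Avoider α∈) (∈avoiders⇒Is231Avoider β∈)

  ++-injective-length : ∀ {A : Set} (α α′ β β′ : List A) →
    length α ≡ length α′ → α ++ β ≡ α′ ++ β′ → α ≡ α′ × β ≡ β′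
  ++-injective-length [] [] β β′ _ e = refl , e
  ++-injective-length (x ∷ α) (x′ ∷ α′) β β′ |α| e with ∷-injective e
  ... | refl , e′ with ++-injective-length α α′ β β′ (suc-injective |α|) e′
  ... | refl , e″ = refl , e″

  assemble-injectiveʳ : ∀ m α {β β′} → assemble m α β ≡ assemble m α β′ → β ≡ β′
  assemble-injectiveʳ m α {β} {β′} e =
    map-injective (+-cancelʳ-≡ (suc m) _ _) (proj₂ (++-injective-length α α _ _ refl (∷-injectiveʳ e)))

  assemble-injectiveˡ : ∀ m {α α′ β β′} → length α ≡ length α′ → assemble m α β ≡ assemble m α′ β′ → α ≡ α′
  assemble-injectiveˡ m {α} {α′} |α| e = proj₁ (++-injective-length α α′ _ _ |α| (∷-injectiveʳ e))

  assembliesWithHead-head : ∀ n m {l} → l ∈ assembliesWithHead n m → Σ[ rest ∈ List ℕ ] l ≡ m ∷ rest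
  assembliesWithHead-head n m l∈ with find (∈-concatMap⁻ (λ α → map (assemble m α) (avoiders (n ∸ m))) {xs = avoiders m} l∈)
  ... | α , _ , l∈map with ∈-map⁻ (assemble m α) l∈map
  ... | β , _ , refl = _ , refl

  assemblies-unique : ∀ n → Unique (assemblies n)
  assemblies-unique n = Unique-concatMap (assembliesWithHead n) (upTo (suc n)) (Unique.upTo⁺ (suc n))
    (λ {m} _ → Unique-concatMap (λ α → map (assemble m α) (avoiders (n ∸ m))) (avoiders m) (avoiders-unique m)
       (λ _ → Unique.map⁺ (assemble-injectiveʳ m _) (avoiders-unique (n ∸ m))) (same-α m))
    same-head
    where
    same-α : ∀ m {α α′ l} → α ∈ avoiders m → α′ ∈ avoiders m →
      l ∈ map (assemble m α) (avoiders (n ∸ m)) → l ∈ map (assemble m α′) (avoiders (n ∸ m)) → α ≡ α′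
    same-α m α∈ α′∈ l∈ l∈′ with ∈-map⁻ (assemble m _) l∈ | ∈-map⁻ (assemble m _) l∈′
    ... | _ , _ , refl | _ , _ , e =
      assemble-injectiveˡ m (trans (proj₁ (∈avoiders⇒Is231Avoider α∈)) (sym (proj₁ (∈avoiders⇒Is231Avoider α′∈)))) e
    same-head : ∀ {m m′ l} → m ∈ upTo (suc n) → m′ ∈ upTo (suc n) →
      l ∈ assembliesWithHead n m → l ∈ assembliesWithHead n m′ → m ≡ m′
    same-head {m} {m′} _ _ l∈ l∈′ with assembliesWithHead-head n m l∈ | assembliesWithHead-head n m′ l∈′
    ... | _ , refl | _ , e = proj₁ (∷-injective e)

  All<suc∧∉⇒All< : ∀ {k} ys → All (_< suc k) ys → k ∉ ys → All (_< k) ys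
  All<suc∧∉⇒All< [] _ _ = []
  All<suc∧∉⇒All< (y ∷ ys) (p ∷ ps) k∉ =
    ≤∧≢⇒< (≤-pred p) (λ e → k∉ (here (sym e))) ∷ All<suc∧∉⇒All< ys ps (λ m → k∉ (there m))

  Unique-length≤ : ∀ k (xs : List ℕ) → Unique xs → All (_< k) xs → length xs ≤ k
  Unique-length≤ zero [] _ _ = z≤n
  Unique-length≤ zero (x ∷ xs) _ (() ∷ _)
  Unique-length≤ (suc k) xs u xs<1+k with k ∈? xs
  ... | no k∉xs = m≤n⇒m≤1+n (Unique-length≤ k xs u (All<suc∧∉⇒All< xs xs<1+k k∉xs))
  ... | yes k∈xs with ∈-∃++ k∈xs
  ... | as , bs , refl with Unique-delete as u
  ... | u′ , k∉ = subst (_≤ suc k) (sym (length-++-middle as))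
    (s≤s (Unique-length≤ k (as ++ bs) u′ (All<suc∧∉⇒All< (as ++ bs) (All-delete as xs<1+k) k∉)))
    where
    length-++-middle : ∀ (as : List ℕ) {x bs} → length (as ++ x ∷ bs) ≡ suc (length (as ++ bs))
    length-++-middle [] = refl
    length-++-middle (a ∷ as) = cong suc (length-++-middle as)

  data StartsAtLeast (v : ℕ) : List ℕ → Set where
    []  : StartsAtLeast v []
    _∷_ : ∀ {y} (v≤y : v ≤ y) ys → StartsAtLeast v (y ∷ ys)

  splitBelow : ∀ v xs → Σ[ α ∈ List ℕ ] Σ[ β ∈ List ℕ ] xs ≡ α ++ β × All (_< v) α × StartsAtLeast v β
  splitBelow v [] = [] , [] , refl , [] , []
  splitBelow v (y ∷ ys) with y <? v
  ... | no y≮v = [] , y ∷ ys , refl , [] , (≮⇒≥ y≮v ∷ ys)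
  ... | yes y<v with splitBelow v ys
  ... | α , β , refl , α<v , β≥v = y ∷ α , β , refl , y<v ∷ α<v , β≥v

  countBelow≡0⇒All≥ : ∀ x ys → countBelow x ys ≡ 0 → All (x ≤_) ys
  countBelow≡0⇒All≥ x [] _ = []
  countBelow≡0⇒All≥ x (y ∷ ys) e with y <? x
  ... | yes y<x rewrite <⇒<ᵇ≡true y<x = contradiction e λ ()
    where open import Relation.Nullary using (contradiction)
  ... | no y≮x rewrite ≤⇒<ᵇ≡false {y} {x} (≮⇒≥ y≮x) = ≮⇒≥ y≮x ∷ countBelow≡0⇒All≥ x ys e

  -- An entry below v after the first entry y > v would complete the 2-3-1 v y w.
  above-after-split : ∀ v α β → All (_< v) α → StartsAtLeast v β → All (v ≢_) (α ++ β) →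
    count231From v (α ++ β) ≡ 0 → All (v <_) β
  above-after-split v α [] _ _ _ _ = []
  above-after-split v α (y ∷ ys) α<v (v≤y ∷ .ys) v≢ no231 with All.++⁻ʳ α v≢
  ... | v≢y ∷ v≢ys = v<y ∷ All.zipWith (λ (v≤w , v≢w) → ≤∧≢⇒< v≤w v≢w) (countBelow≡0⇒All≥ v ys below-v≡0 , v≢ys)
    where
    v<y = ≤∧≢⇒< v≤y v≢y
    below-v≡0 : countBelow v ys ≡ 0
    below-v≡0 = m+n≡0⇒m≡0 _ (subst (λ b → (if b then countBelow v ys else 0) + count231From v ys ≡ 0) (<⇒<ᵇ≡true v<y)
      (trans (sym (count231From-low-++ α (y ∷ ys) α<v)) no231))

  lengths-forced : ∀ {v n a b} → v ≤ n → a ≤ v → b ≤ n ∸ v → a + b ≡ n → a ≡ v × b ≡ n ∸ v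
  lengths-forced {v} {n} {a} {b} v≤n a≤v b≤n∸v a+b≡n = a≡v , trans (sym (m+n∸m≡n a b)) (cong₂ _∸_ a+b≡n a≡v)
    where
    open ≤-Reasoning
    a≡v : a ≡ v
    a≡v = ≤-antisym a≤v (begin
      v            ≡⟨ m∸[m∸n]≡n v≤n ⟨
      n ∸ (n ∸ v)  ≤⟨ ∸-monoʳ-≤ n b≤n∸v ⟩
      n ∸ b        ≡⟨ cong (_∸ b) a+b≡n ⟨
      a + b ∸ b    ≡⟨ m+n∸n≡m a b ⟩
      a            ∎)

  Is231Avoider-decompose : ∀ {n v rest} → Is231Avoider (suc n) (v ∷ rest) →
    v ≤ n × Σ[ α ∈ List ℕ ] Σ[ β ∈ List ℕ ] Is231Avoider v α × Is231Avoider (n ∸ v) β × v ∷ rest ≡ assemble v α β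
  Is231Avoider-decompose {n} {v} {rest} (|l| , (v<1+n ∷ rest<1+n) , (v∉ ∷ rest-unique) , no231)
    with splitBelow v rest
  ... | α , β′ , refl , α<v , β′≥v =
    v≤n , α , β , (|α| , α<v , α-unique , α-no231) , (|β| , β<n∸v , β-unique , β-no231)
    , cong (λ γ → v ∷ α ++ γ) (sym β-shift)
    where
    v≤n = ≤-pred v<1+n
    v<β′ : All (v <_) β′
    v<β′ = above-after-split v α β′ α<v β′≥v v∉ (m+n≡0⇒m≡0 _ no231)
    β = map (_∸ suc v) β′
    β-shift : shift (suc v) β ≡ β′
    β-shift = unshift β′ v<β′
      where
      unshift : ∀ γ → All (v <_) γ → shift (suc v) (map (_∸ suc v) γ) ≡ γ
      unshift [] [] = refl
      unshift (z ∷ γ) (p ∷ ps) = cong₂ _∷_ (m∸n+n≡m p) (unshift γ ps)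
    α-unique : Unique α
    α-unique = proj₁ (Unique-++⁻ α rest-unique)
    β-unique : Unique β
    β-unique = Unique.map⁻ (subst Unique (sym β-shift) (proj₂ (Unique-++⁻ α rest-unique)))
    α+β′-no231 : count231 α + count231 β′ ≡ 0
    α+β′-no231 = trans (sym (Separated.count231-separated v α β′ α<v v<β′)) (m+n≡0⇒n≡0 _ no231)
    α-no231 : count231 α ≡ 0
    α-no231 = m+n≡0⇒m≡0 _ α+β′-no231
    β-no231 : count231 β ≡ 0
    β-no231 = trans (sym (count231-shift (suc v) β)) (trans (cong count231 β-shift) (m+n≡0⇒n≡0 _ α+β′-no231))
    β<n∸v : All (_< n ∸ v) β
    β<n∸v = All.map⁺ (All.zipWith (λ (v<w , w<1+n) → ∸-monoˡ-< {o = suc n} w<1+n v<w) (v<β′ , All.++⁻ʳ α rest<1+n))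
    |α|,|β| : length α ≡ v × length β ≡ n ∸ v
    |α|,|β| = lengths-forced v≤n (Unique-length≤ v α α-unique α<v) (Unique-length≤ (n ∸ v) β β-unique β<n∸v)
      (trans (cong (length α +_) (length-map (_∸ suc v) β′)) (trans (sym (length-++ α)) (suc-injective |l|)))
    |α| = proj₁ |α|,|β|
    |β| = proj₂ |α|,|β|

  Is231Avoider⇒∈assemblies : ∀ {n l} → Is231Avoider (suc n) l → l ∈ assemblies n
  Is231Avoider⇒∈assemblies {n} {v ∷ rest} a with Is231Avoider-decompose a
  ... | v≤n , α , β , α-avoider , β-avoider , refl =
    ∈-concatMap⁺ (assembliesWithHead n) {xs = upTo (suc n)} (Any.map (λ { refl →
      ∈-concatMap⁺ (λ α → map (assemble v α) (avoiders (n ∸ v))) {xs = avoiders v}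
        (Any.map (λ { refl → ∈-map⁺ (assemble v α) (Is231Avoider⇒∈avoiders β-avoider) })
                 (Is231Avoider⇒∈avoiders α-avoider)) })
      (∈-upTo⁺ (s≤s v≤n)))

  count12-assemble : ∀ m α β → All (_< m) α →
    count12 (assemble m α β) ≡ length β + (count12 α + count12 β + length α * length β)
  count12-assemble m α β α<m = cong₂ _+_
    (trans (countAbove-++ m α β′)
      (cong₂ _+_ (countAbove-none α α<m) (trans (countAbove-all β′ m<β′) (length-map (_+ suc m) β))))
    (trans (Separated.count12-separated m α β′ α<m m<β′)
      (cong₂ _+_ (cong (count12 α +_) (count12-shift (suc m) β)) (cong (length α *_) (length-map (_+ suc m) β))))
    where
    β′ = shift (suc m) β
    m<β′ = shift-above m β

  count123-assemble : ∀ m α β → All (_< m) α →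
    count123 (assemble m α β) ≡ count12 β + (count123 α + count123 β + count12 α * length β + length α * count12 β)
  count123-assemble m α β α<m = cong₂ _+_
    (trans (count123From-low-++ α β′ α<m) (trans (count123From-all β′ m<β′) (count12-shift (suc m) β)))
    (trans (Separated.count123-separated m α β′ α<m m<β′)
      (cong₂ _+_ (cong₂ _+_ (cong (count123 α +_) (count123-shift (suc m) β))
                            (cong (count12 α *_) (length-map (_+ suc m) β)))
                 (cong (length α *_) (count12-shift (suc m) β))))
    where
    β′ = shift (suc m) β
    m<β′ = shift-above m β

module FunctionalEquations where

  open ListSums
  open PowerSeries
  open EulerOperator
  open PatternCounts
  open UniqueLists
  open Avoiders
  open Decomposition
  open import Data.Nat using (ℕ; zero; suc; _+_; _*_; _∸_; _<_)
  open import Data.Nat.Solver using (module +-*-Solver)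
  open +-*-Solver using (_:+_; _:*_; _:=_; con) renaming (solve to solveℕ)
  open import Data.List using (List; []; _∷_; length; upTo)
  open import Data.List.Membership.Propositional using (_∈_)
  open import Data.List.Relation.Unary.All using (All)
  open import Data.Product using (_×_; _,_; proj₁; proj₂)
  open import Function using (_∘_)
  open import Relation.Binary.PropositionalEquality

  countSeries count12Series count123Series : Series
  countSeries n = sumMap (λ _ → 1) (avoiders n)
  count12Series n = sumMap count12 (avoiders n)
  count123Series n = sumMap count123 (avoiders n)

  private
    c p t : Series
    c = countSeries
    p = count12Series
    t = count123Series

  sumMap-avoiders-suc : ∀ n (F : List ℕ → ℕ) → sumMap F (avoiders (suc n)) ≡
    sumMap (λ m → sumMap (λ α → sumMap (λ β → F (assemble m α β)) (avoiders (n ∸ m))) (avoiders m)) (upTo (suc n))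
  sumMap-avoiders-suc n F = begin
    sumMap F (avoiders (suc n))
      ≡⟨ sumMap-Unique-sameElements F (avoiders (suc n)) (assemblies n) (avoiders-unique (suc n)) (assemblies-unique n)
           (Is231Avoider⇒∈assemblies ∘ ∈avoiders⇒Is231Avoider) (Is231Avoider⇒∈avoiders ∘ ∈assemblies⇒Is231Avoider) ⟩
    sumMap F (assemblies n)
      ≡⟨ sumMap-concatMap F (assembliesWithHead n) (upTo (suc n)) ⟩
    sumMap (λ m → sumMap F (assembliesWithHead n m)) (upTo (suc n))
      ≡⟨ sumMap-cong (λ m → trans (sumMap-concatMap F _ (avoiders m))
           (sumMap-cong (λ α → sumMap-map F (assemble m α) (avoiders (n ∸ m))) (avoiders m))) (upTo (suc n)) ⟩
    sumMap (λ m → sumMap (λ α → sumMap (λ β → F (assemble m α β)) (avoiders (n ∸ m))) (avoiders m)) (upTo (suc n))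
      ∎
    where open ≡-Reasoning

  length-avoiders : ∀ {n l} → l ∈ avoiders n → length l ≡ n
  length-avoiders l∈ = proj₁ (∈avoiders⇒Is231Avoider l∈)

  bounded-avoiders : ∀ {n l} → l ∈ avoiders n → All (_< n) l
  bounded-avoiders l∈ = proj₁ (proj₂ (∈avoiders⇒Is231Avoider l∈))

  sumMap-avoiders-length : ∀ n → sumMap (λ _ → n * 1) (avoiders n) ≡ Dₛ c n
  sumMap-avoiders-length n = sumMap-*ˡ n (λ _ → 1) (avoiders n)

  count12-sum : ∀ n m → let k = n ∸ m in
    sumMap (λ α → sumMap (λ β → count12 (assemble m α β)) (avoiders k)) (avoiders m)
      ≡ c m * Dₛ c k + p m * c k + c m * p k + Dₛ c m * Dₛ c k
  count12-sum n m = begin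
    sumMap (λ α → sumMap (λ β → count12 (assemble m α β)) (avoiders k)) (avoiders m)
      ≡⟨ sumMap-cong-∈ (avoiders m) (λ α∈ → sumMap-cong-∈ (avoiders k) (λ β∈ → as-terms α∈ β∈)) ⟩
    sumMap (λ α → sumMap (λ β → sumMap (λ (u , v) → u α * v β) terms) (avoiders k)) (avoiders m)
      ≡⟨ sumMap²-bilinear (avoiders m) (avoiders k) terms ⟩
    c m * sumMap (λ _ → k * 1) (avoiders k)
      + (p m * c k + (c m * p k + (sumMap (λ _ → m * 1) (avoiders m) * sumMap (λ _ → k * 1) (avoiders k) + 0)))
      ≡⟨ cong₂ (λ x y → c m * x + (p m * c k + (c m * p k + (y * x + 0))))
           (sumMap-avoiders-length k) (sumMap-avoiders-length m) ⟩
    c m * Dₛ c k + (p m * c k + (c m * p k + (Dₛ c m * Dₛ c k + 0)))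
      ≡⟨ solveℕ 4 (λ a b e f → a :+ (b :+ (e :+ (f :+ con 0))) := a :+ b :+ e :+ f) refl
           (c m * Dₛ c k) (p m * c k) (c m * p k) (Dₛ c m * Dₛ c k) ⟩
    c m * Dₛ c k + p m * c k + c m * p k + Dₛ c m * Dₛ c k
      ∎
    where
    open ≡-Reasoning
    k = n ∸ m
    terms : List ((List ℕ → ℕ) × (List ℕ → ℕ))
    terms = ((λ _ → 1) , (λ _ → k * 1)) ∷ (count12 , (λ _ → 1)) ∷ ((λ _ → 1) , count12)
          ∷ ((λ _ → m * 1) , (λ _ → k * 1)) ∷ []
    as-terms : ∀ {α β} → α ∈ avoiders m → β ∈ avoiders k →
      count12 (assemble m α β) ≡ sumMap (λ (u , v) → u α * v β) terms
    as-terms {α} {β} α∈ β∈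
      rewrite count12-assemble m α β (bounded-avoiders α∈) | length-avoiders α∈ | length-avoiders β∈ =
      solveℕ 4 (λ k a b m → k :+ (a :+ b :+ m :* k)
                            := con 1 :* (k :* con 1) :+ (a :* con 1 :+ (con 1 :* b :+ ((m :* con 1) :* (k :* con 1) :+ con 0))))
        refl k (count12 α) (count12 β) m

  count123-sum : ∀ n m → let k = n ∸ m in
    sumMap (λ α → sumMap (λ β → count123 (assemble m α β)) (avoiders k)) (avoiders m)
      ≡ c m * p k + t m * c k + c m * t k + p m * Dₛ c k + Dₛ c m * p k
  count123-sum n m = begin
    sumMap (λ α → sumMap (λ β → count123 (assemble m α β)) (avoiders k)) (avoiders m)
      ≡⟨ sumMap-cong-∈ (avoiders m) (λ α∈ → sumMap-cong-∈ (avoiders k) (λ β∈ → as-terms α∈ β∈)) ⟩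
    sumMap (λ α → sumMap (λ β → sumMap (λ (u , v) → u α * v β) terms) (avoiders k)) (avoiders m)
      ≡⟨ sumMap²-bilinear (avoiders m) (avoiders k) terms ⟩
    c m * p k + (t m * c k + (c m * t k
      + (p m * sumMap (λ _ → k * 1) (avoiders k) + (sumMap (λ _ → m * 1) (avoiders m) * p k + 0))))
      ≡⟨ cong₂ (λ x y → c m * p k + (t m * c k + (c m * t k + (p m * x + (y * p k + 0)))))
           (sumMap-avoiders-length k) (sumMap-avoiders-length m) ⟩
    c m * p k + (t m * c k + (c m * t k + (p m * Dₛ c k + (Dₛ c m * p k + 0))))
      ≡⟨ solveℕ 5 (λ a b e f g → a :+ (b :+ (e :+ (f :+ (g :+ con 0)))) := a :+ b :+ e :+ f :+ g) refl
           (c m * p k) (t m * c k) (c m * t k) (p m * Dₛ c k) (Dₛ c m * p k) ⟩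
    c m * p k + t m * c k + c m * t k + p m * Dₛ c k + Dₛ c m * p k
      ∎
    where
    open ≡-Reasoning
    k = n ∸ m
    terms : List ((List ℕ → ℕ) × (List ℕ → ℕ))
    terms = ((λ _ → 1) , count12) ∷ (count123 , (λ _ → 1)) ∷ ((λ _ → 1) , count123)
          ∷ (count12 , (λ _ → k * 1)) ∷ ((λ _ → m * 1) , count12) ∷ []
    as-terms : ∀ {α β} → α ∈ avoiders m → β ∈ avoiders k →
      count123 (assemble m α β) ≡ sumMap (λ (u , v) → u α * v β) terms
    as-terms {α} {β} α∈ β∈
      rewrite count123-assemble m α β (bounded-avoiders α∈) | length-avoiders α∈ | length-avoiders β∈ =
      solveℕ 6 (λ k a b x y m → b :+ (x :+ y :+ a :* k :+ m :* b)
                                := con 1 :* b :+ (x :* con 1 :+ (con 1 :* y :+ (a :* (k :* con 1) :+ ((m :* con 1) :* b :+ con 0)))))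
        refl k (count12 α) (count12 β) (count123 α) (count123 β) m

  countSeries-eq : c ≈ₛ 1ₛ ⊕ zₛ ⊛ (c ⊛ c)
  countSeries-eq zero = refl
  countSeries-eq (suc n) = begin
    c (suc n)
      ≡⟨ sumMap-avoiders-suc n (λ _ → 1) ⟩
    sumMap (λ m → sumMap (λ α → sumMap (λ β → 1) (avoiders (n ∸ m))) (avoiders m)) (upTo (suc n))
      ≡⟨ sumMap-cong (λ m → sumMap²-* (avoiders m) (avoiders (n ∸ m)) (λ _ → 1) (λ _ → 1)) (upTo (suc n)) ⟩
    (c ⊛ c) n
      ≡⟨ zₛ⊛-suc (c ⊛ c) n ⟨
    (zₛ ⊛ (c ⊛ c)) (suc n)
      ∎
    where open ≡-Reasoning

  count12Series-eq : p ≈ₛ zₛ ⊛ ((c ⊛ Dₛ c) ⊕ (p ⊛ c) ⊕ (c ⊛ p) ⊕ (Dₛ c ⊛ Dₛ c))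
  count12Series-eq zero = refl
  count12Series-eq (suc n) = begin
    p (suc n)
      ≡⟨ sumMap-avoiders-suc n count12 ⟩
    sumMap (λ m → sumMap (λ α → sumMap (λ β → count12 (assemble m α β)) (avoiders (n ∸ m))) (avoiders m)) U
      ≡⟨ sumMap-cong (count12-sum n) U ⟩
    sumMap (λ m → f₁ m + f₂ m + f₃ m + f₄ m) U
      ≡⟨ sumMap-+ (λ m → f₁ m + f₂ m + f₃ m) f₄ U ⟩
    sumMap (λ m → f₁ m + f₂ m + f₃ m) U + sumMap f₄ U
      ≡⟨ cong (_+ sumMap f₄ U) (sumMap-+ (λ m → f₁ m + f₂ m) f₃ U) ⟩
    sumMap (λ m → f₁ m + f₂ m) U + sumMap f₃ U + sumMap f₄ U
      ≡⟨ cong (λ x → x + sumMap f₃ U + sumMap f₄ U) (sumMap-+ f₁ f₂ U) ⟩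
    (X ⊕ Y) n
      ≡⟨ zₛ⊛-suc (X ⊕ Y) n ⟨
    (zₛ ⊛ (X ⊕ Y)) (suc n)
      ∎
    where
    open ≡-Reasoning
    U = upTo (suc n)
    X = (c ⊛ Dₛ c) ⊕ (p ⊛ c) ⊕ (c ⊛ p)
    Y = Dₛ c ⊛ Dₛ c
    f₁ f₂ f₃ f₄ : ℕ → ℕ
    f₁ m = c m * Dₛ c (n ∸ m)
    f₂ m = p m * c (n ∸ m)
    f₃ m = c m * p (n ∸ m)
    f₄ m = Dₛ c m * Dₛ c (n ∸ m)

  count123Series-eq : t ≈ₛ zₛ ⊛ ((c ⊛ p) ⊕ (t ⊛ c) ⊕ (c ⊛ t) ⊕ (p ⊛ Dₛ c) ⊕ (Dₛ c ⊛ p))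
  count123Series-eq zero = refl
  count123Series-eq (suc n) = begin
    t (suc n)
      ≡⟨ sumMap-avoiders-suc n count123 ⟩
    sumMap (λ m → sumMap (λ α → sumMap (λ β → count123 (assemble m α β)) (avoiders (n ∸ m))) (avoiders m)) U
      ≡⟨ sumMap-cong (count123-sum n) U ⟩
    sumMap (λ m → f₁ m + f₂ m + f₃ m + f₄ m + f₅ m) U
      ≡⟨ sumMap-+ (λ m → f₁ m + f₂ m + f₃ m + f₄ m) f₅ U ⟩
    sumMap (λ m → f₁ m + f₂ m + f₃ m + f₄ m) U + sumMap f₅ U
      ≡⟨ cong (_+ sumMap f₅ U) (sumMap-+ (λ m → f₁ m + f₂ m + f₃ m) f₄ U) ⟩
    sumMap (λ m → f₁ m + f₂ m + f₃ m) U + sumMap f₄ U + sumMap f₅ U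
      ≡⟨ cong (λ x → x + sumMap f₄ U + sumMap f₅ U) (sumMap-+ (λ m → f₁ m + f₂ m) f₃ U) ⟩
    sumMap (λ m → f₁ m + f₂ m) U + sumMap f₃ U + sumMap f₄ U + sumMap f₅ U
      ≡⟨ cong (λ x → x + sumMap f₃ U + sumMap f₄ U + sumMap f₅ U) (sumMap-+ f₁ f₂ U) ⟩
    (X ⊕ Y) n
      ≡⟨ zₛ⊛-suc (X ⊕ Y) n ⟨
    (zₛ ⊛ (X ⊕ Y)) (suc n)
      ∎
    where
    open ≡-Reasoning
    U = upTo (suc n)
    X = (c ⊛ p) ⊕ (t ⊛ c) ⊕ (c ⊛ t) ⊕ (p ⊛ Dₛ c)
    Y = Dₛ c ⊛ p
    f₁ f₂ f₃ f₄ f₅ : ℕ → ℕ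
    f₁ m = c m * p (n ∸ m)
    f₂ m = t m * c (n ∸ m)
    f₃ m = c m * t (n ∸ m)
    f₄ m = p m * Dₛ c (n ∸ m)
    f₅ m = Dₛ c m * p (n ∸ m)

open FunctionalEquations
open Avoiders using (total123≡sumMap-count123)

corollary3p5 : (n : ℕ) → total123 n ≡ z³· ((Bser ^ˢ 5) ⊛ (Cser ^ˢ 3)) n
corollary3p5 n = trans (total123≡sumMap-count123 n)
  (CatalanSystem.t≈z³·B⁵C³ countSeries count12Series count123Series countSeries-eq count12Series-eq count123Series-eq n)
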